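{- Let $\phi=(\phi_1,\phi_2,\dots)$ with $\phi_i\in\mathfrak S_i$, and let $T=T(D,R)$ be an increasing balanced path diagram. Then Algorithm $\mathrm{HPath}^{\phi_k^{ -1}}$ applied to $T$ terminates and outputs a general Dyck path $\overline D=\mathrm{HPath}^{\phi_k^{ -1}}(T)$ satisfying $\mathrm{Osweep}(\overline D)=D$ (the V-path of $T$).
   Context: A path diagram $T(D,R)$, $D=(b_1,\dots,b_N)$, $R=(r_1,\dots,r_N)$, consists of arrows $A_i=(1,b_i)$ starting at $(i,r_i)$ with end rank $r_i+b_i$; $D$ is its V-path. Red arrow: $b_i>0$, segment in row $j$ (strip between heights $j,j+1$) iff $r_i\le j\le r_i+b_i-1$; blue: $b_i<0$, segment in row $j$ iff $r_i+b_i\le j\le r_i-1$. Row count $c(j)$ = #red minus #blue segments in row $j$; balanced: all $c(j)=0$; increasing: $r_1\le\dots\le r_N$. A general Dyck path is an integer sequence $(b_1,\dots,b_N)$ with sum $0$ and $b_1+\dots+b_{i-1}\ge0$ for all $i$; its $i$-th arrow has starting rank $b_1+\dots+b_{i-1}$. Order sweep map: with $i_1<\dots<i_k$ the indices of the arrows of starting rank $0$, $\mathrm{Osweep}(P)$ lists the steps ordered by starting rank $0,1,2,\dots$; equal rank $r\ne0$ from right to left; rank $0$ in the order $b_{i_{\phi_k(1)}},\dots,b_{i_{\phi_k(k)}}$. Algorithm $\mathrm{HPath}^{\phi_k^{ -1}}$: Step 1: current level $:=0$, $\mathfrak n:=0$, $k:=$ number of arrows of the current diagram starting at level $0$. Step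 2: for $i=1,\dots,N$: if the current level is $0$, $\mathfrak n:=\mathfrak n+1$ and $A_j$ is the $\phi_k^{ -1}(\mathfrak n)$-th arrow from the left among those starting at level $0$; otherwise $A_j$ is the rightmost unlabelled arrow starting at the current level. If none exists go to Step 3; else label $A_j$ by $i$, $\pi(i):=j$, current level $:=$ end rank of $A_j$. Step 3: shift all unlabelled arrows one level down, erase labels, go to Step 1. Step 4: once all arrows are labelled, output $(b_{\pi(1)},\dots,b_{\pi(N)})$.
   Formalization: The starting ranks $r_i$ of the path diagram $T(D,R)$ are nonnegative integers, not arbitrary integers. The statement above fails without it. -}

module Defs where

open import Data.Bool using (Bool; true; false; if_then_else_; not; _∧_)
open import Data.Nat as ℕ using (ℕ; zero; suc)
open import Data.Integer as ℤ using (ℤ; +_; 0ℤ; 1ℤ; -1ℤ; _+_; _-_; ∣_∣)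
open import Data.List using (List; []; _∷_; length; zip; zipWith; map; reverse; filterᵇ; _++_; concat; upTo; foldr; lookup; allFin; last; replicate)
open import Data.List.Relation.Unary.All using (All)
open import Data.List.Relation.Unary.Linked using (Linked)
open import Data.Maybe using (Maybe; just; nothing)
open import Data.Product using (_×_; _,_; proj₁; proj₂)
open import Data.Sum using (_⊎_; inj₁; inj₂)
open import Data.Fin using (Fin; fromℕ<)
open import Data.Fin.Permutation using (Permutation′; _⟨$⟩ʳ_; _⟨$⟩ˡ_)
open import Relation.Nullary using (does; yes; no)
open import Relation.Binary.PropositionalEquality using (_≡_)

_≤ᵇ_ : ℤ → ℤ → Bool
x ≤ᵇ y = does (x ℤ.≤? y)

_<ᵇ_ : ℤ → ℤ → Bool
x <ᵇ y = does (x ℤ.<? y)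

_==_ : ℤ → ℤ → Bool
x == y = does (x ℤ.≟ y)

sumℤ : List ℤ → ℤ
sumℤ = foldr _+_ 0ℤ

-- A family φ = (φ_0, φ_1, φ_2, ...) with φ_k ∈ 𝔖_k  (φ_0 is irrelevant)
PermFamily : Set
PermFamily = (k : ℕ) → Permutation′ k

-- Path diagrams T(D,R): D = (b_1..b_N) ∈ ℤ^N, R = (r_1..r_N) ∈ ℕ^N,
-- arrow A_i = (1,b_i) starting at (i, r_i).

-- contribution of the arrow (b, r) to the row count c(j) of row j
segment : ℤ → ℤ → ℤ → ℤ
segment b r j =
  if 0ℤ <ᵇ b
  then (if (r ≤ᵇ j) ∧ (j ≤ᵇ (r + b - 1ℤ)) then 1ℤ else 0ℤ)
  else (if b <ᵇ 0ℤ
        then (if ((r + b) ≤ᵇ j) ∧ (j ≤ᵇ (r - 1ℤ)) then -1ℤ else 0ℤ)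
        else 0ℤ)

-- c(j) = #red segments in row j − #blue segments in row j
rowCount : List ℤ → List ℕ → ℤ → ℤ
rowCount D R j = sumℤ (zipWith (λ b r → segment b (+ r) j) D R)

Balanced : List ℤ → List ℕ → Set
Balanced D R = ∀ (j : ℤ) → rowCount D R j ≡ 0ℤ

Increasing : List ℕ → Set
Increasing R = Linked ℕ._≤_ R

startRanksFrom : ℤ → List ℤ → List ℤ
startRanksFrom s [] = []
startRanksFrom s (b ∷ bs) = s ∷ startRanksFrom (s + b) bs

startRanks : List ℤ → List ℤ
startRanks = startRanksFrom 0ℤ

GeneralDyck : List ℤ → Set
GeneralDyck P = (sumℤ P ≡ 0ℤ) × All (0ℤ ℤ.≤_) (startRanks P)

stepsAtRank : ℤ → List ℤ → List ℤ
stepsAtRank r P = map proj₁ (filterᵇ (λ p → proj₂ p == r) (zip P (startRanks P)))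

-- rank 0 part: b_{i_{φ_k(1)}}, …, b_{i_{φ_k(k)}}
rankZeroPart : PermFamily → List ℤ → List ℤ
rankZeroPart φ L0 = map (λ m → lookup L0 (φ (length L0) ⟨$⟩ʳ m)) (allFin (length L0))

-- all starting ranks of a general Dyck path lie in 0 .. Σ|b_i|
Osweep : PermFamily → List ℤ → List ℤ
Osweep φ P =
  rankZeroPart φ (stepsAtRank 0ℤ P)
  ++ concat (map (λ m → reverse (stepsAtRank (+ suc m) P)) (upTo (foldr (λ b s → ∣ b ∣ ℕ.+ s) 0 P)))

-- Algorithm HPath^{φ_k^{-1}}
-- current diagram: list of arrows (b_i , current starting level)

Arrows : Set
Arrows = List (ℤ × ℤ)

indexed : {A : Set} → List A → List (ℕ × A)
indexed xs = zip (upTo (length xs)) xs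

lookupℕ : {A : Set} → List A → ℕ → Maybe A
lookupℕ [] _ = nothing
lookupℕ (x ∷ xs) zero = just x
lookupℕ (x ∷ xs) (suc n) = lookupℕ xs n

setTrue : List Bool → ℕ → List Bool
setTrue [] _ = []
setTrue (x ∷ xs) zero = true ∷ xs
setTrue (x ∷ xs) (suc n) = x ∷ setTrue xs n

level0Idx : Arrows → List ℕ
level0Idx T = map proj₁ (filterᵇ (λ p → proj₂ (proj₂ p) == 0ℤ) (indexed T))

-- at level 0: the φ_k^{-1}(𝔫)-th arrow among those starting at level 0,
-- where the argument n = 𝔫 − 1 (0-based) and k = number of such arrows
chooseZero : PermFamily → List ℕ → ℕ → Maybe ℕ
chooseZero φ idx0 n with n ℕ.<? length idx0
... | yes n<k = just (lookup idx0 (φ (length idx0) ⟨$⟩ˡ fromℕ< n<k))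
... | no _ = nothing

rightmostUnlabelled : ℤ → Arrows → List Bool → Maybe ℕ
rightmostUnlabelled ℓ T lab =
  last (map proj₁ (filterᵇ (λ p → (proj₂ (proj₁ (proj₂ p)) == ℓ) ∧ not (proj₂ (proj₂ p)))
                           (indexed (zip T lab))))

-- label arrow j (if any): new current level, labels, output so far
labelStep : Arrows → List Bool → List ℤ → Maybe ℕ → Maybe (ℤ × List Bool × List ℤ)
labelStep T lab acc nothing = nothing
labelStep T lab acc (just j) with lookupℕ T j
... | nothing = nothing
... | just (b , lvl) = just (lvl + b , setTrue lab j , acc ++ (b ∷ []))

-- Step 2 (remaining iterations `it`, current level ℓ, 𝔫 = n).
-- inj₁ out : all arrows labelled, output (b_{π(1)},…,b_{π(N)});
-- inj₂ lab : no arrow found, with the current labels (go to Step 3)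
roundLoop : PermFamily → Arrows → List ℕ → ℕ → ℤ → ℕ → List Bool → List ℤ → List ℤ ⊎ List Bool
roundLoop φ T idx0 zero ℓ n lab acc = inj₁ acc
roundLoop φ T idx0 (suc it) ℓ n lab acc with ℓ == 0ℤ
... | true with labelStep T lab acc (chooseZero φ idx0 n)
...   | nothing = inj₂ lab
...   | just (ℓ' , lab' , acc') = roundLoop φ T idx0 it ℓ' (suc n) lab' acc'
roundLoop φ T idx0 (suc it) ℓ n lab acc | false with labelStep T lab acc (rightmostUnlabelled ℓ T lab)
...   | nothing = inj₂ lab
...   | just (ℓ' , lab' , acc') = roundLoop φ T idx0 it ℓ' n lab' acc'

round : PermFamily → Arrows → List ℤ ⊎ List Bool
round φ T = roundLoop φ T (level0Idx T) (length T) 0ℤ 0 (replicate (length T) false) []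

shift : Arrows → List Bool → Arrows
shift T lab = zipWith (λ a l → if l then a else (proj₁ a , proj₂ a - 1ℤ)) T lab

-- run the algorithm for at most `fuel` rounds; `just out` iff it terminated
hpathRun : PermFamily → ℕ → Arrows → Maybe (List ℤ)
hpathRun φ zero T = nothing
hpathRun φ (suc f) T with round φ T
... | inj₁ out = just out
... | inj₂ lab = hpathRun φ f (shift T lab)

HPath : PermFamily → ℕ → List ℤ → List ℕ → Maybe (List ℤ)
HPath φ fuel D R = hpathRun φ fuel (zip D (map +_ R))

module Submission where

open import Defs
open import Data.Bool as Bool using (Bool; true; false; if_then_else_; not; _∧_)
open import Data.Nat as ℕ using (ℕ; zero; suc; z≤n; s≤s)
import Data.Nat.Properties as ℕP
open import Data.Integer as ℤ using (ℤ; +_; 0ℤ; 1ℤ; -1ℤ; _+_; _-_; ∣_∣)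
import Data.Integer.Properties as ℤP
open import Data.List using (List; []; _∷_; length; zip; zipWith; map; reverse; filterᵇ; _++_; concat; upTo; foldr; lookup; last; replicate; applyUpTo; [_]; tabulate)
import Data.List.Properties as LP
import Data.Bool.Properties as BP
open import Data.Maybe using (Maybe; just; nothing; fromMaybe)
open import Data.Maybe.Properties using (just-injective)
open import Data.Product using (_×_; _,_; proj₁; proj₂; ∃-syntax)
open import Function using (_∘_; case_of_)
open import Data.Sum using (_⊎_; inj₁; inj₂)
open import Data.Empty using (⊥-elim)
open import Data.Unit using (tt)
open import Relation.Nullary using (¬_; yes; no)
open import Relation.Nullary.Decidable using (dec-true; dec-false; T?)
open import Relation.Binary.PropositionalEquality hiding ([_])
open import Data.List.Relation.Unary.All as All using (All; []; _∷_)
import Data.List.Relation.Unary.All.Properties as AllP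
open import Data.List.Relation.Unary.AllPairs as AllPairs using (AllPairs; []; _∷_)
import Data.List.Relation.Unary.AllPairs.Properties as AllPairsP
open import Data.List.Relation.Unary.Linked.Properties using (Linked⇒AllPairs)
open import Data.Integer.Tactic.RingSolver using (solve-∀)
open import Algebra.Properties.CommutativeSemigroup ℕP.+-commutativeSemigroup using (x∙yz≈y∙xz; xy∙z≈zx∙y; interchange)
open import Data.Fin using (Fin; fromℕ<; toℕ)
import Data.Fin.Properties as FP
open import Data.Fin.Permutation using (_⟨$⟩ʳ_; _⟨$⟩ˡ_; inverseˡ; inverseʳ)

-- A round of HPath is a walk along arrows: at level 0 it takes the level-0
-- arrows in the order φ_k⁻¹, elsewhere the rightmost unused arrow at the
-- current level.  Since every level starts as many arrows as it ends, the walk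
-- can only get stuck at level 0 once all level-0 arrows are used.  The used
-- arrows then form a closed walk, so the unused ones are still balanced;
-- lowering them by one keeps the diagram balanced, increasing and nonnegative
-- while decreasing the sum of the levels, which bounds the number of rounds.
-- In the last round every arrow is used and the current level is the rank, so
-- the output is a general Dyck path whose steps of rank r ≠ 0 are the arrows
-- of level r read from right to left, and whose steps of rank 0 are the
-- level-0 arrows permuted by φ_k⁻¹.  Osweep undoes both reorderings, and as the
-- diagram is increasing, concatenating its levels gives back D.

==⇒≡ : ∀ {x y} → (x == y) ≡ true → x ≡ y
==⇒≡ {x} {y} e with x ℤ.≟ y
... | yes x≡y = x≡y

T-==⇒≡ : ∀ {x y} → Bool.T (x == y) → x ≡ y
T-==⇒≡ {x} {y} t with x ℤ.≟ y
... | yes x≡y = x≡y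

==-refl : ∀ x → (x == x) ≡ true
==-refl x = dec-true (x ℤ.≟ x) refl

≢⇒==-false : ∀ {x y} → ¬ x ≡ y → (x == y) ≡ false
≢⇒==-false {x} {y} = dec-false (x ℤ.≟ y)

∧≡true⁻ : ∀ u v → u ∧ v ≡ true → u ≡ true × v ≡ true
∧≡true⁻ true true _ = refl , refl

𝟙 : Bool → ℕ
𝟙 true = 1
𝟙 false = 0

𝟙-pos⇒true : ∀ b → 1 ℕ.≤ 𝟙 b → b ≡ true
𝟙-pos⇒true true _ = refl

module _ {A : Set} where

  lookupℕ-ext : ∀ (xs ys : List A) → (∀ i → lookupℕ xs i ≡ lookupℕ ys i) → xs ≡ ys
  lookupℕ-ext [] [] h = refl
  lookupℕ-ext [] (y ∷ ys) h with () ← h 0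
  lookupℕ-ext (x ∷ xs) [] h with () ← h 0
  lookupℕ-ext (x ∷ xs) (y ∷ ys) h with refl ← h 0 = cong (x ∷_) (lookupℕ-ext xs ys (λ i → h (suc i)))

  lookupℕ-just⇒< : ∀ (xs : List A) i {x} → lookupℕ xs i ≡ just x → i ℕ.< length xs
  lookupℕ-just⇒< (x ∷ xs) zero e = s≤s z≤n
  lookupℕ-just⇒< (x ∷ xs) (suc i) e = s≤s (lookupℕ-just⇒< xs i e)

  <⇒lookupℕ-just : ∀ (xs : List A) i → i ℕ.< length xs → ∃[ x ] lookupℕ xs i ≡ just x
  <⇒lookupℕ-just (x ∷ xs) zero p = x , refl
  <⇒lookupℕ-just (x ∷ xs) (suc i) (s≤s p) = <⇒lookupℕ-just xs i p

  ≥⇒lookupℕ-nothing : ∀ (xs : List A) i → length xs ℕ.≤ i → lookupℕ xs i ≡ nothing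
  ≥⇒lookupℕ-nothing [] i p = refl
  ≥⇒lookupℕ-nothing (x ∷ xs) (suc i) (s≤s p) = ≥⇒lookupℕ-nothing xs i p

  lookupℕ-lookup : ∀ (xs : List A) (i : Fin (length xs)) → lookupℕ xs (toℕ i) ≡ just (lookup xs i)
  lookupℕ-lookup (x ∷ xs) Fin.zero = refl
  lookupℕ-lookup (x ∷ xs) (Fin.suc i) = lookupℕ-lookup xs i

  lookupℕ-replicate : ∀ n (x : A) i → i ℕ.< n → lookupℕ (replicate n x) i ≡ just x
  lookupℕ-replicate (suc n) x zero p = refl
  lookupℕ-replicate (suc n) x (suc i) (s≤s p) = lookupℕ-replicate n x i p

  lookupℕ-replicate⁻ : ∀ n (x : A) i {y} → lookupℕ (replicate n x) i ≡ just y → y ≡ x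
  lookupℕ-replicate⁻ (suc n) x zero refl = refl
  lookupℕ-replicate⁻ (suc n) x (suc i) e = lookupℕ-replicate⁻ n x i e

  lookupℕ-applyUpTo : ∀ (f : ℕ → A) n t → t ℕ.< n → lookupℕ (applyUpTo f n) t ≡ just (f t)
  lookupℕ-applyUpTo f (suc n) zero p = refl
  lookupℕ-applyUpTo f (suc n) (suc t) (s≤s p) = lookupℕ-applyUpTo (λ z → f (suc z)) n t p

  lookupℕ-tabulate : ∀ {n} (f : Fin n → A) t (p : t ℕ.< n) → lookupℕ (tabulate f) t ≡ just (f (fromℕ< p))
  lookupℕ-tabulate {suc n} f zero p = refl
  lookupℕ-tabulate {suc n} f (suc t) (s≤s p) = lookupℕ-tabulate (λ z → f (Fin.suc z)) t p

  lookupℕ⇒All : ∀ {P : A → Set} (xs : List A) → (∀ j {y} → lookupℕ xs j ≡ just y → P y) → All P xs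
  lookupℕ⇒All [] h = []
  lookupℕ⇒All (x ∷ xs) h = h 0 refl ∷ lookupℕ⇒All xs (λ j → h (suc j))

  All⇒lookupℕ : ∀ {P : A → Set} (xs : List A) → All P xs → ∀ j {y} → lookupℕ xs j ≡ just y → P y
  All⇒lookupℕ (x ∷ xs) (p ∷ ps) zero refl = p
  All⇒lookupℕ (x ∷ xs) (p ∷ ps) (suc j) e = All⇒lookupℕ xs ps j e

  AllPairs⇒lookupℕ : ∀ {R : A → A → Set} (xs : List A) → AllPairs R xs →
    ∀ i j {x y} → i ℕ.< j → lookupℕ xs i ≡ just x → lookupℕ xs j ≡ just y → R x y
  AllPairs⇒lookupℕ (x ∷ xs) (p ∷ ps) zero (suc j) lt refl e = All⇒lookupℕ xs p j e
  AllPairs⇒lookupℕ (x ∷ xs) (p ∷ ps) (suc i) (suc j) (s≤s lt) e e' = AllPairs⇒lookupℕ xs ps i j lt e e'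

  lookupℕ⇒AllPairs : ∀ {R : A → A → Set} (xs : List A) →
    (∀ i j {x y} → i ℕ.< j → lookupℕ xs i ≡ just x → lookupℕ xs j ≡ just y → R x y) → AllPairs R xs
  lookupℕ⇒AllPairs [] h = []
  lookupℕ⇒AllPairs (x ∷ xs) h =
    lookupℕ⇒All xs (λ j → h 0 (suc j) (s≤s z≤n) refl) ∷ lookupℕ⇒AllPairs xs (λ i j lt → h (suc i) (suc j) (s≤s lt))

module _ {A B : Set} where

  lookupℕ-zip : ∀ (xs : List A) (ys : List B) i {x y} →
    lookupℕ xs i ≡ just x → lookupℕ ys i ≡ just y → lookupℕ (zip xs ys) i ≡ just (x , y)
  lookupℕ-zip (x ∷ xs) (y ∷ ys) zero refl refl = refl
  lookupℕ-zip (x ∷ xs) (y ∷ ys) (suc i) e e' = lookupℕ-zip xs ys i e e'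

  lookupℕ-zip⁻ : ∀ (xs : List A) (ys : List B) i {x y} →
    lookupℕ (zip xs ys) i ≡ just (x , y) → lookupℕ xs i ≡ just x × lookupℕ ys i ≡ just y
  lookupℕ-zip⁻ (x ∷ xs) (y ∷ ys) zero refl = refl , refl
  lookupℕ-zip⁻ (x ∷ xs) (y ∷ ys) (suc i) e = lookupℕ-zip⁻ xs ys i e

  lookupℕ-map : ∀ (f : A → B) (xs : List A) i {x} → lookupℕ xs i ≡ just x → lookupℕ (map f xs) i ≡ just (f x)
  lookupℕ-map f (x ∷ xs) zero refl = refl
  lookupℕ-map f (x ∷ xs) (suc i) e = lookupℕ-map f xs i e

  lookupℕ-map⁻ : ∀ (f : A → B) (xs : List A) i {z} → lookupℕ (map f xs) i ≡ just z → ∃[ x ] (lookupℕ xs i ≡ just x × z ≡ f x)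
  lookupℕ-map⁻ f (x ∷ xs) zero refl = x , refl , refl
  lookupℕ-map⁻ f (x ∷ xs) (suc i) e = lookupℕ-map⁻ f xs i e

  lookupℕ-zipWith⁻ : ∀ {C : Set} (f : A → B → C) (xs : List A) (ys : List B) i {z} →
    lookupℕ (zipWith f xs ys) i ≡ just z → ∃[ x ] ∃[ y ] (lookupℕ xs i ≡ just x × lookupℕ ys i ≡ just y × z ≡ f x y)
  lookupℕ-zipWith⁻ f (x ∷ xs) (y ∷ ys) zero refl = x , y , refl , refl , refl
  lookupℕ-zipWith⁻ f (x ∷ xs) (y ∷ ys) (suc i) e = lookupℕ-zipWith⁻ f xs ys i e

length-setTrue : ∀ l j → length (setTrue l j) ≡ length l
length-setTrue [] j = refl
length-setTrue (x ∷ l) zero = refl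
length-setTrue (x ∷ l) (suc j) = cong suc (length-setTrue l j)

lookupℕ-setTrue-≡ : ∀ l j {x} → lookupℕ l j ≡ just x → lookupℕ (setTrue l j) j ≡ just true
lookupℕ-setTrue-≡ (y ∷ l) zero e = refl
lookupℕ-setTrue-≡ (y ∷ l) (suc j) e = lookupℕ-setTrue-≡ l j e

lookupℕ-setTrue-≢ : ∀ l j i → ¬ i ≡ j → lookupℕ (setTrue l j) i ≡ lookupℕ l i
lookupℕ-setTrue-≢ [] j i i≢j = refl
lookupℕ-setTrue-≢ (x ∷ l) zero zero i≢j = ⊥-elim (i≢j refl)
lookupℕ-setTrue-≢ (x ∷ l) zero (suc i) i≢j = refl
lookupℕ-setTrue-≢ (x ∷ l) (suc j) zero i≢j = refl
lookupℕ-setTrue-≢ (x ∷ l) (suc j) (suc i) i≢j = lookupℕ-setTrue-≢ l j i (i≢j ∘ cong suc)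

lookupℕ-setTrue-true : ∀ l j i → lookupℕ l i ≡ just true → lookupℕ (setTrue l j) i ≡ just true
lookupℕ-setTrue-true l j i e with i ℕ.≟ j
... | yes refl = lookupℕ-setTrue-≡ l j e
... | no i≢j = trans (lookupℕ-setTrue-≢ l j i i≢j) e

enumerateFrom : {A : Set} → ℕ → List A → List (ℕ × A)
enumerateFrom s [] = []
enumerateFrom s (x ∷ xs) = (s , x) ∷ enumerateFrom (suc s) xs

indexed≡enumerateFrom0 : ∀ {A : Set} (xs : List A) → indexed xs ≡ enumerateFrom 0 xs
indexed≡enumerateFrom0 xs = go (λ i → i) 0 xs (λ i → refl)
  where
  go : ∀ {A : Set} (f : ℕ → ℕ) s (xs : List A) → (∀ i → f i ≡ s ℕ.+ i) → zip (applyUpTo f (length xs)) xs ≡ enumerateFrom s xs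
  go f s [] h = refl
  go f s (x ∷ xs) h = cong₂ _∷_ (cong (_, x) (trans (h 0) (ℕP.+-identityʳ s)))
                                (go (λ i → f (suc i)) (suc s) xs (λ i → trans (h (suc i)) (ℕP.+-suc s i)))

module _ {C : Set} (q : C → Bool) where

  hits : ℕ → List C → List (ℕ × C)
  hits s xs = filterᵇ (λ p → q (proj₂ p)) (enumerateFrom s xs)

  hits-sound : ∀ s xs t j c → lookupℕ (hits s xs) t ≡ just (j , c) → ∃[ u ] (j ≡ s ℕ.+ u × lookupℕ xs u ≡ just c × q c ≡ true)
  hits-sound s [] t j c ()
  hits-sound s (c₀ ∷ xs) t j c e with q c₀ in qc₀
  hits-sound s (c₀ ∷ xs) zero .s .c₀ refl | true = 0 , sym (ℕP.+-identityʳ s) , refl , qc₀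
  hits-sound s (c₀ ∷ xs) (suc t) j c e | true with hits-sound (suc s) xs t j c e
  ... | u , refl , e′ , qc = suc u , sym (ℕP.+-suc s u) , e′ , qc
  hits-sound s (c₀ ∷ xs) t j c e | false with hits-sound (suc s) xs t j c e
  ... | u , refl , e′ , qc = suc u , sym (ℕP.+-suc s u) , e′ , qc

  hits-lower : ∀ s xs t j c → lookupℕ (hits s xs) t ≡ just (j , c) → s ℕ.≤ j
  hits-lower s xs t j c e with hits-sound s xs t j c e
  ... | u , refl , _ = ℕP.m≤m+n s u

  hits-injective : ∀ s xs t t′ j c c′ → lookupℕ (hits s xs) t ≡ just (j , c) → lookupℕ (hits s xs) t′ ≡ just (j , c′) → t ≡ t′
  hits-injective s [] t t′ j c c′ () e′
  hits-injective s (c₀ ∷ xs) t t′ j c c′ e e′ with q c₀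
  ... | false = hits-injective (suc s) xs t t′ j c c′ e e′
  hits-injective s (c₀ ∷ xs) zero zero j c c′ e e′ | true = refl
  hits-injective s (c₀ ∷ xs) zero (suc t′) .s .c₀ c′ refl e′ | true = ⊥-elim (ℕP.n≮n s (hits-lower (suc s) xs t′ s c′ e′))
  hits-injective s (c₀ ∷ xs) (suc t) zero .s c .c₀ e refl | true = ⊥-elim (ℕP.n≮n s (hits-lower (suc s) xs t s c e))
  hits-injective s (c₀ ∷ xs) (suc t) (suc t′) j c c′ e e′ | true = cong suc (hits-injective (suc s) xs t t′ j c c′ e e′)

  hits-complete : ∀ s xs u c → lookupℕ xs u ≡ just c → q c ≡ true → ∃[ t ] lookupℕ (hits s xs) t ≡ just (s ℕ.+ u , c)
  hits-complete s (c₀ ∷ xs) zero .c₀ refl qc rewrite qc = 0 , cong (λ z → just (z , c₀)) (sym (ℕP.+-identityʳ s))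
  hits-complete s (c₀ ∷ xs) (suc u) c e qc with hits-complete (suc s) xs u c e qc
  ... | t , e′ with q c₀
  ...   | false = t , trans e′ (cong (λ z → just (z , c)) (sym (ℕP.+-suc s u)))
  ...   | true = suc t , trans e′ (cong (λ z → just (z , c)) (sym (ℕP.+-suc s u)))

  map-proj₂-hits : ∀ s xs → map proj₂ (hits s xs) ≡ filterᵇ q xs
  map-proj₂-hits s [] = refl
  map-proj₂-hits s (c ∷ xs) with q c
  ... | false = map-proj₂-hits (suc s) xs
  ... | true = cong (c ∷_) (map-proj₂-hits (suc s) xs)

  lastHit : ℕ → List C → Maybe ℕ
  lastHit s xs = last (map proj₁ (hits s xs))

  private
    last-∷-just : ∀ (y : ℕ) ys {z} → last ys ≡ just z → last (y ∷ ys) ≡ just z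
    last-∷-just y (x ∷ []) e = e
    last-∷-just y (x ∷ x′ ∷ ys) e = e

    last-∷-nonempty : ∀ (y : ℕ) ys → ¬ last (y ∷ ys) ≡ nothing
    last-∷-nonempty y [] ()
    last-∷-nonempty y (x ∷ ys) e = last-∷-nonempty x ys e

    last-∷-nothing : ∀ (y : ℕ) ys → last ys ≡ nothing → last (y ∷ ys) ≡ just y
    last-∷-nothing y [] e = refl
    last-∷-nothing y (x ∷ ys) e = ⊥-elim (last-∷-nonempty x ys e)

  lastHit-sound : ∀ s xs j → lastHit s xs ≡ just j → ∃[ t ] ∃[ c ] (j ≡ s ℕ.+ t × lookupℕ xs t ≡ just c × q c ≡ true)
  lastHit-sound s (c ∷ xs) j e with q c in qc
  ... | false with lastHit-sound (suc s) xs j e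
  ...   | t , c′ , refl , e′ , qc′ = suc t , c′ , sym (ℕP.+-suc s t) , e′ , qc′
  lastHit-sound s (c ∷ xs) j e | true with lastHit (suc s) xs in eh
  ...   | just z with lastHit-sound (suc s) xs z eh
  ...     | t , c′ , refl , e′ , qc′ =
            suc t , c′ , trans (just-injective (trans (sym e) (last-∷-just s (map proj₁ (hits (suc s) xs)) eh))) (sym (ℕP.+-suc s t)) , e′ , qc′
  lastHit-sound s (c ∷ xs) j e | true | nothing =
    0 , c , trans (just-injective (trans (sym e) (last-∷-nothing s (map proj₁ (hits (suc s) xs)) eh))) (sym (ℕP.+-identityʳ s)) , refl , qc

  lastHit-maximal : ∀ s xs t c → lookupℕ xs t ≡ just c → q c ≡ true → ∃[ t′ ] (lastHit s xs ≡ just (s ℕ.+ t′) × t ℕ.≤ t′)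
  lastHit-maximal s (c ∷ xs) zero .c refl qc rewrite qc with lastHit (suc s) xs in eh
  ... | just z with lastHit-sound (suc s) xs z eh
  ...   | t , _ , refl , _ = suc t , trans (last-∷-just s (map proj₁ (hits (suc s) xs)) eh) (cong just (sym (ℕP.+-suc s t))) , z≤n
  lastHit-maximal s (c ∷ xs) zero .c refl qc | nothing = 0 , trans (last-∷-nothing s (map proj₁ (hits (suc s) xs)) eh) (cong just (sym (ℕP.+-identityʳ s))) , z≤n
  lastHit-maximal s (c ∷ xs) (suc t) c′ e qc′ with lastHit-maximal (suc s) xs t c′ e qc′
  ... | t′ , e′ , t≤t′ with q c
  ...   | false = suc t′ , trans e′ (cong just (sym (ℕP.+-suc s t′))) , s≤s t≤t′
  ...   | true = suc t′ , trans (last-∷-just s (map proj₁ (hits (suc s) xs)) e′) (cong just (sym (ℕP.+-suc s t′))) , s≤s t≤t′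

module _ {A : Set} (w : A → ℕ) where

  total : List A → ℕ
  total [] = 0
  total (a ∷ T) = w a ℕ.+ total T

  labelledTotal : List A → List Bool → ℕ
  labelledTotal [] _ = 0
  labelledTotal (_ ∷ _) [] = 0
  labelledTotal (a ∷ T) (x ∷ l) = (if x then w a else 0) ℕ.+ labelledTotal T l

  unlabelledTotal : List A → List Bool → ℕ
  unlabelledTotal [] _ = 0
  unlabelledTotal (_ ∷ _) [] = 0
  unlabelledTotal (a ∷ T) (x ∷ l) = (if x then 0 else w a) ℕ.+ unlabelledTotal T l

  labelled+unlabelled≡total : ∀ T l → length l ≡ length T → labelledTotal T l ℕ.+ unlabelledTotal T l ≡ total T
  labelled+unlabelled≡total [] [] e = refl
  labelled+unlabelled≡total (a ∷ T) (true ∷ l) e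
    rewrite sym (labelled+unlabelled≡total T l (ℕP.suc-injective e)) = ℕP.+-assoc (w a) _ _
  labelled+unlabelled≡total (a ∷ T) (false ∷ l) e
    rewrite sym (labelled+unlabelled≡total T l (ℕP.suc-injective e)) = x∙yz≈y∙xz (labelledTotal T l) (w a) _

  labelledTotal-setTrue : ∀ T l j {a} → lookupℕ T j ≡ just a → lookupℕ l j ≡ just false →
    labelledTotal T (setTrue l j) ≡ w a ℕ.+ labelledTotal T l
  labelledTotal-setTrue (b ∷ T) (false ∷ l) zero refl refl = refl
  labelledTotal-setTrue (b ∷ T) (x ∷ l) (suc j) {a} e e′
    rewrite labelledTotal-setTrue T l j e e′ = x∙yz≈y∙xz (if x then w b else 0) (w a) _

  labelledTotal-unlabelled : ∀ T n → labelledTotal T (replicate n false) ≡ 0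
  labelledTotal-unlabelled [] n = refl
  labelledTotal-unlabelled (a ∷ T) zero = refl
  labelledTotal-unlabelled (a ∷ T) (suc n) = labelledTotal-unlabelled T n

  unlabelledTotal-labelled : ∀ T l → All (_≡ true) l → unlabelledTotal T l ≡ 0
  unlabelledTotal-labelled [] l h = refl
  unlabelledTotal-labelled (a ∷ T) [] h = refl
  unlabelledTotal-labelled (a ∷ T) (true ∷ l) (refl ∷ h) = unlabelledTotal-labelled T l h

  unlabelledTotal-≥ : ∀ T l i {a} → lookupℕ T i ≡ just a → lookupℕ l i ≡ just false → w a ℕ.≤ unlabelledTotal T l
  unlabelledTotal-≥ (a ∷ T) (false ∷ l) zero refl refl = ℕP.m≤m+n (w a) _
  unlabelledTotal-≥ (a ∷ T) (x ∷ l) (suc i) e e′ = ℕP.≤-trans (unlabelledTotal-≥ T l i e e′) (ℕP.m≤n+m _ _)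

  unlabelledTotal-pos : ∀ T l → 1 ℕ.≤ unlabelledTotal T l →
    ∃[ j ] ∃[ a ] (lookupℕ T j ≡ just a × lookupℕ l j ≡ just false × 1 ℕ.≤ w a)
  unlabelledTotal-pos (a ∷ T) (true ∷ l) p with unlabelledTotal-pos T l p
  ... | j , a′ , e , e′ , q = suc j , a′ , e , e′ , q
  unlabelledTotal-pos (a ∷ T) (false ∷ l) p with w a in eq
  ... | suc _ = 0 , a , refl , refl , subst (1 ℕ.≤_) (sym eq) (s≤s z≤n)
  ... | zero with unlabelledTotal-pos T l p
  ...   | j , a′ , e , e′ , q = suc j , a′ , e , e′ , q

total-+ : ∀ {A : Set} (f g h : A → ℕ) T → (∀ a → f a ℕ.+ g a ≡ h a) → total f T ℕ.+ total g T ≡ total h T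
total-+ f g h [] p = refl
total-+ f g h (a ∷ T) p = trans (interchange (f a) (total f T) (g a) (total g T)) (cong₂ ℕ._+_ (p a) (total-+ f g h T p))

total-1≡length : ∀ {A : Set} (T : List A) → total (λ _ → 1) T ≡ length T
total-1≡length [] = refl
total-1≡length (a ∷ T) = cong suc (total-1≡length T)

unlabelledTotal-cong : ∀ {A : Set} (f g : A → ℕ) T l → (∀ a → f a ≡ g a) → unlabelledTotal f T l ≡ unlabelledTotal g T l
unlabelledTotal-cong f g [] l p = refl
unlabelledTotal-cong f g (a ∷ T) [] p = refl
unlabelledTotal-cong f g (a ∷ T) (x ∷ l) p = cong₂ ℕ._+_ (cong (λ z → if x then 0 else z) (p a)) (unlabelledTotal-cong f g T l p)

unlabelledTotal-strict : ∀ {A : Set} (f g : A → ℕ) T l →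
  (∀ i {a} → lookupℕ T i ≡ just a → lookupℕ l i ≡ just false → f a ℕ.< g a) →
  unlabelledTotal f T l ℕ.+ unlabelledTotal (λ _ → 1) T l ℕ.≤ unlabelledTotal g T l
unlabelledTotal-strict f g [] l h = z≤n
unlabelledTotal-strict f g (a ∷ T) [] h = z≤n
unlabelledTotal-strict f g (a ∷ T) (true ∷ l) h = unlabelledTotal-strict f g T l (λ i → h (suc i))
unlabelledTotal-strict f g (a ∷ T) (false ∷ l) h = begin
  (f a ℕ.+ unlabelledTotal f T l) ℕ.+ (1 ℕ.+ unlabelledTotal (λ _ → 1) T l)
    ≡⟨ interchange (f a) _ 1 _ ⟩
  (f a ℕ.+ 1) ℕ.+ (unlabelledTotal f T l ℕ.+ unlabelledTotal (λ _ → 1) T l)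
    ≤⟨ ℕP.+-mono-≤ (subst (ℕ._≤ g a) (ℕP.+-comm 1 (f a)) (h 0 refl refl))
                   (unlabelledTotal-strict f g T l (λ i → h (suc i))) ⟩
  g a ℕ.+ unlabelledTotal g T l ∎
  where open ℕP.≤-Reasoning

private
  -1+1 : ∀ x → (x - 1ℤ) + 1ℤ ≡ x
  -1+1 = solve-∀
  +1-1 : ∀ y → (y + 1ℤ) - 1ℤ ≡ y
  +1-1 = solve-∀
  -1+-comm : ∀ x b → (x - 1ℤ) + b ≡ (x + b) - 1ℤ
  -1+-comm = solve-∀
  +-interchange : ∀ a b c d → (a - b) + (c - d) ≡ (a + c) - (b + d)
  +-interchange = solve-∀

≤-1⇒< : ∀ {j x} → j ℤ.≤ x - 1ℤ → j ℤ.< x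
≤-1⇒< {j} {x} p = ℤP.i≤pred[j]⇒i<j (subst (j ℤ.≤_) (ℤP.+-comm x -1ℤ) p)

<⇒≤-1 : ∀ {j x} → j ℤ.< x → j ℤ.≤ x - 1ℤ
<⇒≤-1 {j} {x} p = subst (j ℤ.≤_) (ℤP.+-comm -1ℤ x) (ℤP.i<j⇒i≤pred[j] p)

≤+nonneg : ∀ r b → 0ℤ ℤ.≤ b → r ℤ.≤ r + b
≤+nonneg r b p = subst (ℤ._≤ r + b) (ℤP.+-identityʳ r) (ℤP.+-monoʳ-≤ r p)

+nonpos≤ : ∀ r b → b ℤ.≤ 0ℤ → r + b ℤ.≤ r
+nonpos≤ r b p = subst (r + b ℤ.≤_) (ℤP.+-identityʳ r) (ℤP.+-monoʳ-≤ r p)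

nonneg-≢0⇒≥1 : ∀ x → 0ℤ ℤ.≤ x → ¬ x ≡ 0ℤ → 1ℤ ℤ.≤ x
nonneg-≢0⇒≥1 (+ zero) p x≢0 = ⊥-elim (x≢0 refl)
nonneg-≢0⇒≥1 (+ suc n) p x≢0 = ℤ.+≤+ (s≤s z≤n)

∣-1∣< : ∀ x → 1ℤ ℤ.≤ x → ∣ x - 1ℤ ∣ ℕ.< ∣ x ∣
∣-1∣< (+ suc n) p = ℕP.≤-refl
∣-1∣< (+ zero) (ℤ.+≤+ ())

≤∣∣ : ∀ b → b ℤ.≤ + ∣ b ∣
≤∣∣ (+ n) = ℤP.≤-refl
≤∣∣ ℤ.-[1+ n ] = ℤ.-≤+

+m-+n≡0⇒m≡n : ∀ m n → (+ m) - (+ n) ≡ 0ℤ → m ≡ n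
+m-+n≡0⇒m≡n m n e = ℤP.+-injective (ℤP.i-j≡0⇒i≡j (+ m) (+ n) e)

==-pred : ∀ x y → ((x - 1ℤ) == y) ≡ (x == (y + 1ℤ))
==-pred x y with (x - 1ℤ) ℤ.≟ y | x ℤ.≟ (y + 1ℤ)
... | yes _ | yes _ = refl
... | no _ | no _ = refl
... | yes p | no q = ⊥-elim (q (trans (sym (-1+1 x)) (cong (_+ 1ℤ) p)))
... | no p | yes q = ⊥-elim (p (trans (cong (_- 1ℤ) q) (+1-1 y)))

diagram : List ℤ → List ℕ → Arrows
diagram D R = zip D (map +_ R)

endLevel : ℤ × ℤ → ℤ
endLevel a = proj₂ a + proj₁ a

startsAt endsAt : ℤ → ℤ × ℤ → ℕ
startsAt ℓ a = 𝟙 (proj₂ a == ℓ)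
endsAt ℓ a = 𝟙 (endLevel a == ℓ)

StartEndBalanced : Arrows → Set
StartEndBalanced T = ∀ ℓ → total (startsAt ℓ) T ≡ total (endsAt ℓ) T

-- An arrow crosses row j iff exactly one of its two endpoints lies at a level ≤ j.
segment≡ : ∀ b r j → segment b r j ≡ (+ 𝟙 (r ≤ᵇ j)) - (+ 𝟙 ((r + b) ≤ᵇ j))
segment≡ b r j with 0ℤ ℤ.<? b
segment≡ b r j | yes b>0 with r ℤ.≤? j | (r + b) ℤ.≤? j | j ℤ.≤? (r + b - 1ℤ)
... | yes _ | yes p | yes q = ⊥-elim (ℤP.<-irrefl refl (ℤP.≤-<-trans p (≤-1⇒< q)))
... | yes _ | yes _ | no _ = refl
... | yes _ | no _ | yes _ = refl
... | yes _ | no p | no q = ⊥-elim (q (<⇒≤-1 (ℤP.≰⇒> p)))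
... | no p | yes q | _ = ⊥-elim (p (ℤP.≤-trans (≤+nonneg r b (ℤP.<⇒≤ b>0)) q))
... | no _ | no _ | yes _ = refl
... | no _ | no _ | no _ = refl
segment≡ b r j | no b≯0 with b ℤ.<? 0ℤ
segment≡ b r j | no b≯0 | yes b<0 with r ℤ.≤? j | (r + b) ℤ.≤? j | j ℤ.≤? (r - 1ℤ)
... | yes p | no q | _ = ⊥-elim (q (ℤP.≤-trans (+nonpos≤ r b (ℤP.<⇒≤ b<0)) p))
... | yes p | yes _ | yes q = ⊥-elim (ℤP.<-irrefl refl (ℤP.≤-<-trans p (≤-1⇒< q)))
... | yes _ | yes _ | no _ = refl
... | no _ | yes _ | yes _ = refl
... | no p | yes _ | no q = ⊥-elim (q (<⇒≤-1 (ℤP.≰⇒> p)))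
... | no _ | no _ | yes _ = refl
... | no _ | no _ | no _ = refl
segment≡ b r j | no b≯0 | no b≮0 with b ℤ.≟ 0ℤ
... | no b≢0 = ⊥-elim (b≢0 (ℤP.≤-antisym (ℤP.≮⇒≥ b≯0) (ℤP.≮⇒≥ b≮0)))
... | yes refl rewrite ℤP.+-identityʳ r with r ≤ᵇ j
... | true = refl
... | false = refl

startsAtOrBelow endsAtOrBelow : ℤ → Arrows → ℕ
startsAtOrBelow j = total (λ a → 𝟙 (proj₂ a ≤ᵇ j))
endsAtOrBelow j = total (λ a → 𝟙 (endLevel a ≤ᵇ j))

rowCount≡ : ∀ D R j → length D ≡ length R →
  rowCount D R j ≡ (+ startsAtOrBelow j (diagram D R)) - (+ endsAtOrBelow j (diagram D R))
rowCount≡ [] [] j e = refl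
rowCount≡ (b ∷ D) (r ∷ R) j len = begin
  segment b (+ r) j ℤ.+ rowCount D R j
    ≡⟨ cong₂ _+_ (segment≡ b (+ r) j) (rowCount≡ D R j (ℕP.suc-injective len)) ⟩
  (+ s₀ - + e₀) + (+ s - + e)
    ≡⟨ +-interchange (+ s₀) (+ e₀) (+ s) (+ e) ⟩
  (+ s₀ + + s) - (+ e₀ + + e)
    ≡⟨ sym (cong₂ _-_ (ℤP.pos-+ s₀ s) (ℤP.pos-+ e₀ e)) ⟩
  + (s₀ ℕ.+ s) - + (e₀ ℕ.+ e) ∎
  where
  open ≡-Reasoning
  s₀ = 𝟙 ((+ r) ≤ᵇ j)
  e₀ = 𝟙 (((+ r) + b) ≤ᵇ j)
  s = startsAtOrBelow j (diagram D R)
  e = endsAtOrBelow j (diagram D R)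

𝟙-≤-split : ∀ x ℓ → 𝟙 (x == ℓ) ℕ.+ 𝟙 (x ≤ᵇ (ℓ - 1ℤ)) ≡ 𝟙 (x ≤ᵇ ℓ)
𝟙-≤-split x ℓ with x ℤ.≟ ℓ | x ℤ.≤? (ℓ - 1ℤ) | x ℤ.≤? ℓ
... | yes refl | yes q | _ = ⊥-elim (ℤP.<-irrefl refl (≤-1⇒< q))
... | yes refl | no _ | yes _ = refl
... | yes refl | no _ | no q = ⊥-elim (q ℤP.≤-refl)
... | no _ | yes q | yes _ = refl
... | no _ | yes q | no r = ⊥-elim (r (ℤP.<⇒≤ (≤-1⇒< q)))
... | no _ | no _ | no _ = refl
... | no p | no q | yes r = ⊥-elim (q (<⇒≤-1 (ℤP.≤∧≢⇒< r p)))

Balanced⇒StartEndBalanced : ∀ D R → length D ≡ length R → Balanced D R → StartEndBalanced (diagram D R)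
Balanced⇒StartEndBalanced D R e bal ℓ = ℕP.+-cancelʳ-≡ _ _ _ (begin
  total (startsAt ℓ) T ℕ.+ startsAtOrBelow (ℓ - 1ℤ) T ≡⟨ total-+ _ _ _ T (λ a → 𝟙-≤-split (proj₂ a) ℓ) ⟩
  startsAtOrBelow ℓ T                                ≡⟨ starts≡ends ℓ ⟩
  endsAtOrBelow ℓ T                                  ≡⟨ total-+ _ _ _ T (λ a → 𝟙-≤-split (endLevel a) ℓ) ⟨
  total (endsAt ℓ) T ℕ.+ endsAtOrBelow (ℓ - 1ℤ) T    ≡⟨ cong (total (endsAt ℓ) T ℕ.+_) (starts≡ends (ℓ - 1ℤ)) ⟨
  total (endsAt ℓ) T ℕ.+ startsAtOrBelow (ℓ - 1ℤ) T  ∎)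
  where
  open ≡-Reasoning
  T = diagram D R
  starts≡ends : ∀ j → startsAtOrBelow j T ≡ endsAtOrBelow j T
  starts≡ends j = +m-+n≡0⇒m≡n _ _ (trans (sym (rowCount≡ D R j e)) (bal j))

module _ {A B : Set} where

  map-proj₁-zip : ∀ (xs : List A) (ys : List B) → length xs ≡ length ys → map proj₁ (zip xs ys) ≡ xs
  map-proj₁-zip [] [] e = refl
  map-proj₁-zip (x ∷ xs) (y ∷ ys) e = cong (x ∷_) (map-proj₁-zip xs ys (ℕP.suc-injective e))

  map-proj₂-zip : ∀ (xs : List A) (ys : List B) → length xs ≡ length ys → map proj₂ (zip xs ys) ≡ ys
  map-proj₂-zip [] [] e = refl
  map-proj₂-zip (x ∷ xs) (y ∷ ys) e = cong (y ∷_) (map-proj₂-zip xs ys (ℕP.suc-injective e))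

LevelSorted : Arrows → Set
LevelSorted = AllPairs (λ a a′ → proj₂ a ℤ.≤ proj₂ a′)

record Admissible (T : Arrows) : Set where
  field
    levels-nonneg : All (λ a → 0ℤ ℤ.≤ proj₂ a) T
    balanced : StartEndBalanced T
    sorted : LevelSorted T

levelSum : Arrows → ℕ
levelSum = total (λ a → ∣ proj₂ a ∣)

admissible-diagram : ∀ D R → length D ≡ length R → Balanced D R → Increasing R → Admissible (diagram D R)
admissible-diagram D R len bal inc = record
  { levels-nonneg = AllP.map⁻ (subst (All (0ℤ ℤ.≤_)) (sym levels≡) (AllP.map⁺ (All.universal (λ _ → ℤ.+≤+ z≤n) R)))
  ; balanced = Balanced⇒StartEndBalanced D R len bal
  ; sorted = AllPairsP.map⁻ (subst (AllPairs ℤ._≤_) (sym levels≡) (AllPairsP.map⁺ (AllPairs.map ℤ.+≤+ (Linked⇒AllPairs ℕP.≤-trans inc))))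
  }
  where
  levels≡ : map proj₂ (diagram D R) ≡ map +_ R
  levels≡ = map-proj₂-zip D (map +_ R) (trans len (sym (LP.length-map +_ R)))

lower : ℤ × ℤ → ℤ × ℤ
lower a = (proj₁ a , proj₂ a - 1ℤ)

lookupℕ-shift⁻ : ∀ T lab i {a} → lookupℕ (shift T lab) i ≡ just a →
  ∃[ a₀ ] ∃[ l ] (lookupℕ T i ≡ just a₀ × lookupℕ lab i ≡ just l × a ≡ (if l then a₀ else lower a₀))
lookupℕ-shift⁻ T lab i = lookupℕ-zipWith⁻ (λ a l → if l then a else lower a) T lab i

map-proj₁-shift : ∀ T lab → length T ≡ length lab → map proj₁ (shift T lab) ≡ map proj₁ T
map-proj₁-shift [] [] e = refl
map-proj₁-shift (a ∷ T) (true ∷ lab) e = cong (proj₁ a ∷_) (map-proj₁-shift T lab (ℕP.suc-injective e))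
map-proj₁-shift (a ∷ T) (false ∷ lab) e = cong (proj₁ a ∷_) (map-proj₁-shift T lab (ℕP.suc-injective e))

total-shift : ∀ (w : ℤ × ℤ → ℕ) T lab → length T ≡ length lab →
  total w (shift T lab) ≡ labelledTotal w T lab ℕ.+ unlabelledTotal (λ a → w (lower a)) T lab
total-shift w [] [] e = refl
total-shift w (a ∷ T) (true ∷ lab) e = trans (cong (w a ℕ.+_) (total-shift w T lab (ℕP.suc-injective e))) (sym (ℕP.+-assoc (w a) _ _))
total-shift w (a ∷ T) (false ∷ lab) e = trans (cong (w (lower a) ℕ.+_) (total-shift w T lab (ℕP.suc-injective e))) (x∙yz≈y∙xz (w (lower a)) (labelledTotal w T lab) _)

startsAt-lower : ∀ ℓ a → startsAt ℓ (lower a) ≡ startsAt (ℓ + 1ℤ) a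
startsAt-lower ℓ a = cong 𝟙 (==-pred (proj₂ a) ℓ)

endsAt-lower : ∀ ℓ a → endsAt ℓ (lower a) ≡ endsAt (ℓ + 1ℤ) a
endsAt-lower ℓ a = cong 𝟙 (trans (cong (_== ℓ) (-1+-comm (proj₂ a) (proj₁ a))) (==-pred (endLevel a) ℓ))

UnlabelledOffZero : Arrows → List Bool → Set
UnlabelledOffZero T lab = ∀ i {a} → lookupℕ T i ≡ just a → lookupℕ lab i ≡ just false → ¬ proj₂ a ≡ 0ℤ

LabelledSuffix : Arrows → List Bool → Set
LabelledSuffix T lab = ∀ i j {a a′} → i ℕ.< j → lookupℕ T i ≡ just a → lookupℕ T j ≡ just a′ →
  proj₂ a ≡ proj₂ a′ → ¬ proj₂ a ≡ 0ℤ → lookupℕ lab i ≡ just true → lookupℕ lab j ≡ just true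

module _ {T : Arrows} {lab : List Bool} (G : Admissible T) (len : length T ≡ length lab) (off0 : UnlabelledOffZero T lab) where
  open Admissible G

  private
    nonneg : ∀ i {a} → lookupℕ T i ≡ just a → 0ℤ ℤ.≤ proj₂ a
    nonneg = All⇒lookupℕ T levels-nonneg

    unlabelled-pos : ∀ i {a} → lookupℕ T i ≡ just a → lookupℕ lab i ≡ just false → 1ℤ ℤ.≤ proj₂ a
    unlabelled-pos i e e′ = nonneg-≢0⇒≥1 _ (nonneg i e) (off0 i e e′)

  shift-levels-nonneg : All (λ a → 0ℤ ℤ.≤ proj₂ a) (shift T lab)
  shift-levels-nonneg = lookupℕ⇒All (shift T lab) nn
    where
    nn : ∀ i {a} → lookupℕ (shift T lab) i ≡ just a → 0ℤ ℤ.≤ proj₂ a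
    nn i e with lookupℕ-shift⁻ T lab i e
    ... | a₀ , true , e₁ , e₂ , refl = nonneg i e₁
    ... | a₀ , false , e₁ , e₂ , refl = ℤP.≤-trans (ℤP.≤-reflexive (sym (ℤP.+-inverseʳ 1ℤ))) (ℤP.+-monoˡ-≤ (ℤ.- 1ℤ) (unlabelled-pos i e₁ e₂))

  shift-sorted : LabelledSuffix T lab → LevelSorted (shift T lab)
  shift-sorted suffix = lookupℕ⇒AllPairs (shift T lab) srt
    where
    ≤ᵢ : ∀ i j {a a′} → i ℕ.< j → lookupℕ T i ≡ just a → lookupℕ T j ≡ just a′ → proj₂ a ℤ.≤ proj₂ a′
    ≤ᵢ = AllPairs⇒lookupℕ T sorted
    srt : ∀ i j {a a′} → i ℕ.< j → lookupℕ (shift T lab) i ≡ just a → lookupℕ (shift T lab) j ≡ just a′ → proj₂ a ℤ.≤ proj₂ a′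
    srt i j lt e e′ with lookupℕ-shift⁻ T lab i e | lookupℕ-shift⁻ T lab j e′
    ... | a₀ , true , e₁ , e₂ , refl | a₁ , true , f₁ , f₂ , refl = ≤ᵢ i j lt e₁ f₁
    ... | a₀ , false , e₁ , e₂ , refl | a₁ , false , f₁ , f₂ , refl = ℤP.+-monoˡ-≤ (ℤ.- 1ℤ) (≤ᵢ i j lt e₁ f₁)
    ... | a₀ , false , e₁ , e₂ , refl | a₁ , true , f₁ , f₂ , refl = ℤP.≤-trans (+nonpos≤ (proj₂ a₀) -1ℤ ℤ.-≤+) (≤ᵢ i j lt e₁ f₁)
    ... | a₀ , true , e₁ , e₂ , refl | a₁ , false , f₁ , f₂ , refl with proj₂ a₀ ℤ.≟ proj₂ a₁
    ...   | no ℓ≢ℓ′ = <⇒≤-1 (ℤP.≤∧≢⇒< (≤ᵢ i j lt e₁ f₁) ℓ≢ℓ′)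
    ...   | yes ℓ≡ℓ′ with () ← trans (sym f₂) (suffix i j lt e₁ f₁ ℓ≡ℓ′ (λ z → off0 j f₁ f₂ (trans (sym ℓ≡ℓ′) z)) e₂)

  shift-balanced : (∀ ℓ → labelledTotal (startsAt ℓ) T lab ≡ labelledTotal (endsAt ℓ) T lab) → StartEndBalanced (shift T lab)
  shift-balanced closed ℓ = begin
    total (startsAt ℓ) (shift T lab)
      ≡⟨ total-shift (startsAt ℓ) T lab len ⟩
    labelledTotal (startsAt ℓ) T lab ℕ.+ unlabelledTotal (λ a → startsAt ℓ (lower a)) T lab
      ≡⟨ cong₂ ℕ._+_ (closed ℓ) (unlabelledTotal-cong _ _ T lab (startsAt-lower ℓ)) ⟩
    labelledTotal (endsAt ℓ) T lab ℕ.+ unlabelledTotal (startsAt (ℓ + 1ℤ)) T lab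
      ≡⟨ cong (labelledTotal (endsAt ℓ) T lab ℕ.+_) (unlabelled-balanced (ℓ + 1ℤ)) ⟩
    labelledTotal (endsAt ℓ) T lab ℕ.+ unlabelledTotal (endsAt (ℓ + 1ℤ)) T lab
      ≡⟨ cong (labelledTotal (endsAt ℓ) T lab ℕ.+_) (unlabelledTotal-cong _ _ T lab (endsAt-lower ℓ)) ⟨
    labelledTotal (endsAt ℓ) T lab ℕ.+ unlabelledTotal (λ a → endsAt ℓ (lower a)) T lab
      ≡⟨ total-shift (endsAt ℓ) T lab len ⟨
    total (endsAt ℓ) (shift T lab) ∎
    where
    open ≡-Reasoning
    split : ∀ w → labelledTotal w T lab ℕ.+ unlabelledTotal w T lab ≡ total w T
    split w = labelled+unlabelled≡total w T lab (sym len)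
    unlabelled-balanced : ∀ ℓ → unlabelledTotal (startsAt ℓ) T lab ≡ unlabelledTotal (endsAt ℓ) T lab
    unlabelled-balanced ℓ = ℕP.+-cancelˡ-≡ (labelledTotal (startsAt ℓ) T lab) _ _
      (trans (split (startsAt ℓ)) (trans (balanced ℓ) (trans (sym (split (endsAt ℓ)))
        (cong (ℕ._+ unlabelledTotal (endsAt ℓ) T lab) (sym (closed ℓ))))))

  levelSum-shift-< : 1 ℕ.≤ unlabelledTotal (λ _ → 1) T lab → levelSum (shift T lab) ℕ.< levelSum T
  levelSum-shift-< some = begin-strict
    levelSum (shift T lab)
      ≡⟨ total-shift (λ a → ∣ proj₂ a ∣) T lab len ⟩
    L ℕ.+ unlabelledTotal (λ a → ∣ proj₂ a - 1ℤ ∣) T lab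
      <⟨ ℕP.+-monoʳ-< L (ℕP.<-≤-trans (ℕP.m<m+n (unlabelledTotal (λ a → ∣ proj₂ a - 1ℤ ∣) T lab) some) (unlabelledTotal-strict _ _ T lab
            (λ i e e′ → ∣-1∣< _ (unlabelled-pos i e e′)))) ⟩
    L ℕ.+ unlabelledTotal (λ a → ∣ proj₂ a ∣) T lab
      ≡⟨ labelled+unlabelled≡total _ T lab (sym len) ⟩
    levelSum T ∎
    where
    open ℕP.≤-Reasoning
    L = labelledTotal (λ a → ∣ proj₂ a ∣) T lab

absSum : List ℤ → ℕ
absSum = foldr (λ b s → ∣ b ∣ ℕ.+ s) 0

absSum-snoc : ∀ P b → absSum (P ++ [ b ]) ≡ absSum P ℕ.+ ∣ b ∣
absSum-snoc [] b = ℕP.+-identityʳ ∣ b ∣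
absSum-snoc (x ∷ P) b = trans (cong (∣ x ∣ ℕ.+_) (absSum-snoc P b)) (sym (ℕP.+-assoc ∣ x ∣ _ _))

sumℤ-snoc : ∀ P b → sumℤ (P ++ [ b ]) ≡ sumℤ P + b
sumℤ-snoc [] b = trans (ℤP.+-identityʳ b) (sym (ℤP.+-identityˡ b))
sumℤ-snoc (x ∷ P) b = trans (cong (λ z → x + z) (sumℤ-snoc P b)) (sym (ℤP.+-assoc x _ _))

length-startRanksFrom : ∀ s P → length (startRanksFrom s P) ≡ length P
length-startRanksFrom s [] = refl
length-startRanksFrom s (x ∷ P) = cong suc (length-startRanksFrom (s + x) P)

startRanksFrom-snoc : ∀ s P b → startRanksFrom s (P ++ [ b ]) ≡ startRanksFrom s P ++ [ s + sumℤ P ]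
startRanksFrom-snoc s [] b = cong [_] (sym (ℤP.+-identityʳ s))
startRanksFrom-snoc s (x ∷ P) b =
  cong (s ∷_) (trans (startRanksFrom-snoc (s + x) P b) (cong (λ z → startRanksFrom (s + x) P ++ [ z ]) (ℤP.+-assoc s x _)))

startRanks-snoc : ∀ P b → startRanks (P ++ [ b ]) ≡ startRanks P ++ [ sumℤ P ]
startRanks-snoc P b = trans (startRanksFrom-snoc 0ℤ P b) (cong (λ z → startRanks P ++ [ z ]) (ℤP.+-identityˡ _))

zip-snoc : ∀ {A B : Set} (xs : List A) (ys : List B) x y → length xs ≡ length ys → zip (xs ++ [ x ]) (ys ++ [ y ]) ≡ zip xs ys ++ [ (x , y) ]
zip-snoc [] [] x y e = refl
zip-snoc (x₁ ∷ xs) (y₁ ∷ ys) x y e = cong ((x₁ , y₁) ∷_) (zip-snoc xs ys x y (ℕP.suc-injective e))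

sumℤ≤absSum : ∀ P → sumℤ P ℤ.≤ + absSum P
sumℤ≤absSum [] = ℤP.≤-refl
sumℤ≤absSum (x ∷ P) = ℤP.≤-trans (ℤP.+-mono-≤ (≤∣∣ x) (sumℤ≤absSum P)) (ℤP.≤-reflexive (sym (ℤP.pos-+ ∣ x ∣ (absSum P))))

absSum-≤-snoc : ∀ P b → + absSum P ℤ.≤ + absSum (P ++ [ b ])
absSum-≤-snoc P b = ℤ.+≤+ (subst (absSum P ℕ.≤_) (sym (absSum-snoc P b)) (ℕP.m≤m+n (absSum P) ∣ b ∣))

stepsAtRank-snoc : ∀ r P b → stepsAtRank r (P ++ [ b ]) ≡ stepsAtRank r P ++ (if sumℤ P == r then [ b ] else [])
stepsAtRank-snoc r P b = begin
  map proj₁ (filterᵇ atR (zip (P ++ [ b ]) (startRanks (P ++ [ b ]))))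
    ≡⟨ cong (λ z → map proj₁ (filterᵇ atR (zip (P ++ [ b ]) z))) (startRanks-snoc P b) ⟩
  map proj₁ (filterᵇ atR (zip (P ++ [ b ]) (startRanks P ++ [ sumℤ P ])))
    ≡⟨ cong (λ z → map proj₁ (filterᵇ atR z)) (zip-snoc P (startRanks P) b (sumℤ P) (sym (length-startRanksFrom 0ℤ P))) ⟩
  map proj₁ (filterᵇ atR (zip P (startRanks P) ++ [ (b , sumℤ P) ]))
    ≡⟨ cong (map proj₁) (LP.filter-++ (λ p → T? (atR p)) (zip P (startRanks P)) _) ⟩
  map proj₁ (filterᵇ atR (zip P (startRanks P)) ++ filterᵇ atR [ (b , sumℤ P) ])
    ≡⟨ LP.map-++ proj₁ (filterᵇ atR (zip P (startRanks P))) _ ⟩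
  stepsAtRank r P ++ map proj₁ (filterᵇ atR [ (b , sumℤ P) ])
    ≡⟨ cong (stepsAtRank r P ++_) last-step ⟩
  stepsAtRank r P ++ (if sumℤ P == r then [ b ] else []) ∎
  where
  open ≡-Reasoning
  atR : ℤ × ℤ → Bool
  atR p = proj₂ p == r
  last-step : map proj₁ (filterᵇ atR [ (b , sumℤ P) ]) ≡ (if sumℤ P == r then [ b ] else [])
  last-step with sumℤ P == r
  ... | true = refl
  ... | false = refl

labelledWhere : (ℤ × ℤ → Bool) → Arrows → List Bool → Arrows
labelledWhere p T lab = map proj₁ (filterᵇ (λ c → p (proj₁ c) ∧ proj₂ c) (zip T lab))

labelledWhere-setTrue-yes : ∀ p T lab j {a} → lookupℕ T j ≡ just a → lookupℕ lab j ≡ just false → p a ≡ true →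
  (∀ i {a′} → i ℕ.< j → lookupℕ T i ≡ just a′ → p a′ ≡ true → lookupℕ lab i ≡ just false) →
  labelledWhere p T (setTrue lab j) ≡ a ∷ labelledWhere p T lab
labelledWhere-setTrue-yes p (a ∷ T) (false ∷ lab) zero refl refl pa h rewrite pa = refl
labelledWhere-setTrue-yes p (a₀ ∷ T) (x ∷ lab) (suc j) e e′ pa h with p a₀ in pa₀
... | false = labelledWhere-setTrue-yes p T lab j e e′ pa (λ i lt → h (suc i) (s≤s lt))
... | true with x | h 0 (s≤s z≤n) refl pa₀
...   | false | _ = labelledWhere-setTrue-yes p T lab j e e′ pa (λ i lt → h (suc i) (s≤s lt))

labelledWhere-setTrue-no : ∀ p T lab j {a} → lookupℕ T j ≡ just a → p a ≡ false →
  labelledWhere p T (setTrue lab j) ≡ labelledWhere p T lab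
labelledWhere-setTrue-no p (a ∷ T) [] j e pa = refl
labelledWhere-setTrue-no p (a ∷ T) (x ∷ lab) zero refl pa rewrite pa = refl
labelledWhere-setTrue-no p (a₀ ∷ T) (x ∷ lab) (suc j) e pa with p a₀ ∧ x
... | true = cong (a₀ ∷_) (labelledWhere-setTrue-no p T lab j e pa)
... | false = labelledWhere-setTrue-no p T lab j e pa

labelledWhere-none : ∀ p T n → labelledWhere p T (replicate n false) ≡ []
labelledWhere-none p [] n = refl
labelledWhere-none p (a ∷ T) zero = refl
labelledWhere-none p (a ∷ T) (suc n) rewrite BP.∧-zeroʳ (p a) = labelledWhere-none p T n

labelledWhere-all : ∀ p T lab → All (_≡ true) lab → length T ≡ length lab → labelledWhere p T lab ≡ filterᵇ p T
labelledWhere-all p [] [] _ _ = refl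
labelledWhere-all p (a ∷ T) (true ∷ lab) (refl ∷ h) e rewrite BP.∧-identityʳ (p a) with p a
... | true = cong (a ∷_) (labelledWhere-all p T lab h (ℕP.suc-injective e))
... | false = labelledWhere-all p T lab h (ℕP.suc-injective e)

atLevel offLevel : ℤ → Arrows → Arrows
atLevel ℓ = filterᵇ (λ a → proj₂ a == ℓ)
offLevel ℓ = filterᵇ (λ a → not (proj₂ a == ℓ))

atLevel-offLevel : ∀ {ℓ ℓ′} → ¬ ℓ′ ≡ ℓ → ∀ T → atLevel ℓ′ (offLevel ℓ T) ≡ atLevel ℓ′ T
atLevel-offLevel ℓ′≢ℓ [] = refl
atLevel-offLevel {ℓ} {ℓ′} ℓ′≢ℓ (a ∷ T) with proj₂ a ℤ.≟ ℓ
... | yes refl rewrite ≢⇒==-false (ℓ′≢ℓ ∘ sym) = atLevel-offLevel ℓ′≢ℓ T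
... | no _ with proj₂ a == ℓ′
...   | true = cong (a ∷_) (atLevel-offLevel ℓ′≢ℓ T)
...   | false = atLevel-offLevel ℓ′≢ℓ T

atLevel-++-offLevel : ∀ ℓ T → LevelSorted T → All (λ a → ℓ ℤ.≤ proj₂ a) T → atLevel ℓ T ++ offLevel ℓ T ≡ T
atLevel-++-offLevel ℓ [] [] [] = refl
atLevel-++-offLevel ℓ (a ∷ T) (a≤T ∷ sorted) (ℓ≤a ∷ ℓ≤T) with proj₂ a ℤ.≟ ℓ
... | yes _ = cong (a ∷_) (atLevel-++-offLevel ℓ T sorted ℓ≤T)
... | no a≢ℓ = cong₂ (λ u v → u ++ (a ∷ v))
        (LP.filter-none (λ x → T? (proj₂ x == ℓ)) (All.map (λ {x} a≤x → ≢ℓ {x} a≤x ∘ T-==⇒≡) a≤T))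
        (LP.filter-all (λ x → T? (not (proj₂ x == ℓ)))
          (All.map (λ {x} a≤x → subst Bool.T (sym (cong not (≢⇒==-false (≢ℓ {x} a≤x)))) tt) a≤T))
  where
  ℓ<a : ℓ ℤ.< proj₂ a
  ℓ<a = ℤP.≤∧≢⇒< ℓ≤a (a≢ℓ ∘ sym)
  ≢ℓ : ∀ {x : ℤ × ℤ} → proj₂ a ℤ.≤ proj₂ x → ¬ proj₂ x ≡ ℓ
  ≢ℓ a≤x x≡ℓ = ℤP.<-irrefl (sym x≡ℓ) (ℤP.<-≤-trans ℓ<a a≤x)

applyUpTo-cong : ∀ {A : Set} {f g : ℕ → A} → (∀ i → f i ≡ g i) → ∀ n → applyUpTo f n ≡ applyUpTo g n
applyUpTo-cong {f = f} {g} f≗g n = trans (sym (LP.map-upTo f n)) (trans (LP.map-cong f≗g (upTo n)) (LP.map-upTo g n))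

LevelIn : ℕ → ℕ → ℤ × ℤ → Set
LevelIn a c x = ∃[ m ] (proj₂ x ≡ + m × a ℕ.≤ m × m ℕ.< a ℕ.+ c)

concat-atLevels : ∀ c a T → LevelSorted T → All (LevelIn a c) T →
  concat (applyUpTo (λ m → atLevel (+ (a ℕ.+ m)) T) c) ≡ T
concat-atLevels zero a [] _ _ = refl
concat-atLevels zero a (x ∷ T) _ ((m , _ , a≤m , m<a+0) ∷ _) =
  ⊥-elim (ℕP.<-irrefl refl (ℕP.<-≤-trans m<a+0 (subst (ℕ._≤ m) (sym (ℕP.+-identityʳ a)) a≤m)))
concat-atLevels (suc c) a T sorted inRange = begin
  atLevel (+ (a ℕ.+ 0)) T ++ concat (applyUpTo (λ m → atLevel (+ (a ℕ.+ suc m)) T) c)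
    ≡⟨ cong₂ (λ u v → atLevel (+ u) T ++ concat v) (ℕP.+-identityʳ a) (applyUpTo-cong higher c) ⟩
  atLevel (+ a) T ++ concat (applyUpTo (λ m → atLevel (+ (suc a ℕ.+ m)) T′) c)
    ≡⟨ cong (atLevel (+ a) T ++_) (concat-atLevels c (suc a) T′ (AllPairsP.filter⁺ _ sorted) inRange′) ⟩
  atLevel (+ a) T ++ T′
    ≡⟨ atLevel-++-offLevel (+ a) T sorted (All.map (λ { (m , refl , a≤m , _) → ℤ.+≤+ a≤m }) inRange) ⟩
  T ∎
  where
  open ≡-Reasoning
  T′ = offLevel (+ a) T
  higher : ∀ m → atLevel (+ (a ℕ.+ suc m)) T ≡ atLevel (+ (suc a ℕ.+ m)) T′
  higher m = trans (cong (λ z → atLevel (+ z) T) (ℕP.+-suc a m))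
                   (sym (atLevel-offLevel (ℕP.m≢1+m+n a ∘ sym ∘ ℤP.+-injective) T))
  inRange′ : All (LevelIn (suc a) c) T′
  inRange′ = All.zipWith (λ {x} → shrink {x}) (AllP.filter⁺ off? inRange , AllP.all-filter off? T)
    where
    off? = λ (x : ℤ × ℤ) → T? (not (proj₂ x == (+ a)))
    shrink : ∀ {x : ℤ × ℤ} → LevelIn a (suc c) x × Bool.T (not (proj₂ x == (+ a))) → LevelIn (suc a) c x
    shrink {x} ((m , refl , a≤m , m<) , off) =
      m , refl , ℕP.≤∧≢⇒< a≤m (λ { refl → subst Bool.T (cong not (==-refl (+ a))) off }) , subst (m ℕ.<_) (ℕP.+-suc a c) m<

map-proj₁-levels : ∀ M T → LevelSorted T → All (LevelIn 0 (suc M)) T →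
  map proj₁ (atLevel 0ℤ T) ++ concat (map (λ m → map proj₁ (atLevel (+ suc m) T)) (upTo M)) ≡ map proj₁ T
map-proj₁-levels M T sorted inRange = begin
  map proj₁ (atLevel 0ℤ T) ++ concat (map (λ m → map proj₁ (atLevel (+ suc m) T)) (upTo M))
    ≡⟨ cong (λ z → map proj₁ (atLevel 0ℤ T) ++ concat z) (LP.map-upTo (λ m → map proj₁ (atLevel (+ suc m) T)) M) ⟩
  map proj₁ (atLevel 0ℤ T) ++ concat (applyUpTo (λ m → map proj₁ (atLevel (+ suc m) T)) M)
    ≡⟨ cong (λ z → map proj₁ (atLevel 0ℤ T) ++ concat z) (LP.map-applyUpTo (λ m → atLevel (+ suc m) T) (map proj₁) M) ⟨
  map proj₁ (atLevel 0ℤ T) ++ concat (map (map proj₁) (applyUpTo (λ m → atLevel (+ suc m) T) M))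
    ≡⟨ cong (map proj₁ (atLevel 0ℤ T) ++_) (LP.concat-map (applyUpTo (λ m → atLevel (+ suc m) T) M)) ⟩
  map proj₁ (atLevel 0ℤ T) ++ map proj₁ (concat (applyUpTo (λ m → atLevel (+ suc m) T) M))
    ≡⟨ LP.map-++ proj₁ (atLevel 0ℤ T) _ ⟨
  map proj₁ (concat (applyUpTo (λ m → atLevel (+ m) T) (suc M)))
    ≡⟨ cong (map proj₁) (concat-atLevels (suc M) 0 T sorted inRange) ⟩
  map proj₁ T ∎
  where open ≡-Reasoning

-- inverseIndex φ K n is φ_K⁻¹(n) on 0-based positions (junk value 0 when n ≥ K)
inverseIndex : PermFamily → ℕ → ℕ → ℕ
inverseIndex φ K n with n ℕ.<? K
... | yes n<K = toℕ (φ K ⟨$⟩ˡ fromℕ< n<K)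
... | no _ = 0

module _ (φ : PermFamily) (K : ℕ) where

  inverseIndex≡ : ∀ n (n<K : n ℕ.< K) → inverseIndex φ K n ≡ toℕ (φ K ⟨$⟩ˡ fromℕ< n<K)
  inverseIndex≡ n n<K with n ℕ.<? K
  ... | yes _ = refl
  ... | no n≮K = ⊥-elim (n≮K n<K)

  inverseIndex-< : ∀ n → n ℕ.< K → inverseIndex φ K n ℕ.< K
  inverseIndex-< n n<K rewrite inverseIndex≡ n n<K = FP.toℕ<n _

  inverseIndex-injective : ∀ m n → m ℕ.< K → n ℕ.< K → inverseIndex φ K m ≡ inverseIndex φ K n → m ≡ n
  inverseIndex-injective m n m<K n<K e rewrite inverseIndex≡ m m<K | inverseIndex≡ n n<K =
    trans (sym (FP.toℕ-fromℕ< m<K)) (trans (cong toℕ fromℕ<≡) (FP.toℕ-fromℕ< n<K))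
    where
    fromℕ<≡ : fromℕ< m<K ≡ fromℕ< n<K
    fromℕ<≡ = trans (sym (inverseʳ (φ K))) (trans (cong (φ K ⟨$⟩ʳ_) (FP.toℕ-injective e)) (inverseʳ (φ K)))

  inverseIndex-of : ∀ (x : Fin K) → inverseIndex φ K (toℕ x) ≡ toℕ (φ K ⟨$⟩ˡ x)
  inverseIndex-of x = trans (inverseIndex≡ (toℕ x) (FP.toℕ<n x)) (cong (λ z → toℕ (φ K ⟨$⟩ˡ z)) (FP.fromℕ<-toℕ x (FP.toℕ<n x)))

  inverseIndex-section : ∀ t (t<K : t ℕ.< K) → inverseIndex φ K (toℕ (φ K ⟨$⟩ʳ fromℕ< t<K)) ≡ t
  inverseIndex-section t t<K =
    trans (inverseIndex-of (φ K ⟨$⟩ʳ fromℕ< t<K)) (trans (cong toℕ (inverseˡ (φ K))) (FP.toℕ-fromℕ< t<K))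

  inverseIndex-surjective : ∀ t → t ℕ.< K → ∃[ m ] (m ℕ.< K × inverseIndex φ K m ≡ t)
  inverseIndex-surjective t t<K = toℕ (φ K ⟨$⟩ʳ fromℕ< t<K) , FP.toℕ<n _ , inverseIndex-section t t<K

rankZeroPart-inverse : ∀ φ (L : List ℤ) (G : ℕ → ℤ) →
  (∀ m → m ℕ.< length L → lookupℕ L m ≡ just (G (inverseIndex φ (length L) m))) →
  rankZeroPart φ L ≡ map G (upTo (length L))
rankZeroPart-inverse φ L G h = lookupℕ-ext _ _ pointwise
  where
  K = length L
  entry : Fin K → ℤ
  entry m = lookup L (φ K ⟨$⟩ʳ m)
  pointwise : ∀ t → lookupℕ (rankZeroPart φ L) t ≡ lookupℕ (map G (upTo K)) t
  pointwise t rewrite LP.map-tabulate (λ i → i) entry | LP.map-upTo G K with t ℕ.<? K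
  ... | no t≮K = trans (≥⇒lookupℕ-nothing (tabulate entry) t (ℕP.≤-trans (ℕP.≤-reflexive (LP.length-tabulate entry)) (ℕP.≮⇒≥ t≮K)))
                      (sym (≥⇒lookupℕ-nothing (applyUpTo G K) t (ℕP.≤-trans (ℕP.≤-reflexive (LP.length-applyUpTo G K)) (ℕP.≮⇒≥ t≮K))))
  ... | yes t<K = begin
    lookupℕ (tabulate entry) t            ≡⟨ lookupℕ-tabulate entry t t<K ⟩
    just (lookup L x)                     ≡⟨ lookupℕ-lookup L x ⟨
    lookupℕ L (toℕ x)                     ≡⟨ h (toℕ x) (FP.toℕ<n x) ⟩
    just (G (inverseIndex φ K (toℕ x)))   ≡⟨ cong (λ z → just (G z)) (inverseIndex-section φ K t t<K) ⟩
    just (G t)                            ≡⟨ lookupℕ-applyUpTo G K t t<K ⟨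
    lookupℕ (applyUpTo G K) t             ∎
    where
    open ≡-Reasoning
    x = φ K ⟨$⟩ʳ fromℕ< t<K

applyUpTo-lookupℕ : ∀ {A : Set} (d : A) xs → applyUpTo (λ t → fromMaybe d (lookupℕ xs t)) (length xs) ≡ xs
applyUpTo-lookupℕ d [] = refl
applyUpTo-lookupℕ d (x ∷ xs) = cong (x ∷_) (applyUpTo-lookupℕ d xs)

module Round (φ : PermFamily) (T : Arrows) (G : Admissible T) where
  open Admissible G

  N : ℕ
  N = length T

  idx0 : List ℕ
  idx0 = level0Idx T

  k : ℕ
  k = length idx0

  φ⁻¹ : ℕ → ℕ
  φ⁻¹ = inverseIndex φ k

  private
    atZero : ℤ × ℤ → Bool
    atZero a = proj₂ a == 0ℤ

    zeroHits : List (ℕ × (ℤ × ℤ))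
    zeroHits = hits atZero 0 T

    idx0≡ : idx0 ≡ map proj₁ zeroHits
    idx0≡ = cong (λ z → map proj₁ (filterᵇ (λ p → atZero (proj₂ p)) z)) (indexed≡enumerateFrom0 T)

  zeroSteps : List ℤ
  zeroSteps = map proj₁ (atLevel 0ℤ T)

  zeroStep : ℕ → ℤ
  zeroStep t = fromMaybe 0ℤ (lookupℕ zeroSteps t)

  k≡length-zeroSteps : k ≡ length zeroSteps
  k≡length-zeroSteps = begin
    length idx0                       ≡⟨ cong length idx0≡ ⟩
    length (map proj₁ zeroHits)       ≡⟨ LP.length-map proj₁ zeroHits ⟩
    length zeroHits                   ≡⟨ LP.length-map proj₂ zeroHits ⟨
    length (map proj₂ zeroHits)       ≡⟨ cong length (map-proj₂-hits atZero 0 T) ⟩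
    length (atLevel 0ℤ T)             ≡⟨ LP.length-map proj₁ (atLevel 0ℤ T) ⟨
    length zeroSteps                  ∎
    where open ≡-Reasoning

  map-zeroStep-upTo : map zeroStep (upTo k) ≡ zeroSteps
  map-zeroStep-upTo = trans (LP.map-upTo zeroStep k) (trans (cong (applyUpTo zeroStep) k≡length-zeroSteps) (applyUpTo-lookupℕ 0ℤ zeroSteps))

  idx0-sound : ∀ t j → lookupℕ idx0 t ≡ just j → ∃[ a ] (lookupℕ T j ≡ just a × proj₂ a ≡ 0ℤ × zeroStep t ≡ proj₁ a)
  idx0-sound t j e rewrite idx0≡ with lookupℕ-map⁻ proj₁ zeroHits t e
  ... | (.j , a) , e′ , refl with hits-sound atZero 0 T t j a e′
  ...   | .j , refl , Tj≡a , a-at-0 = a , Tj≡a , ==⇒≡ a-at-0 , step≡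
    where
    step≡ : zeroStep t ≡ proj₁ a
    step≡ rewrite lookupℕ-map proj₁ (atLevel 0ℤ T) t
                    (subst (λ z → lookupℕ z t ≡ just a) (map-proj₂-hits atZero 0 T) (lookupℕ-map proj₂ zeroHits t e′)) = refl

  idx0-injective : ∀ t t′ j → lookupℕ idx0 t ≡ just j → lookupℕ idx0 t′ ≡ just j → t ≡ t′
  idx0-injective t t′ j e e′ rewrite idx0≡ with lookupℕ-map⁻ proj₁ zeroHits t e | lookupℕ-map⁻ proj₁ zeroHits t′ e′
  ... | (j₁ , a) , e₁ , refl | (j₂ , a′) , e₂ , refl = hits-injective atZero 0 T t t′ j₁ a a′ e₁ e₂

  idx0-complete : ∀ j {a} → lookupℕ T j ≡ just a → proj₂ a ≡ 0ℤ → ∃[ t ] lookupℕ idx0 t ≡ just j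
  idx0-complete j {a} e a-at-0 with hits-complete atZero 0 T j a e (trans (cong (_== 0ℤ) a-at-0) (==-refl 0ℤ))
  ... | t , e′ = t , trans (cong (λ z → lookupℕ z t) idx0≡) (lookupℕ-map proj₁ zeroHits t e′)

  -- the arrow chosen at level 0 when 𝔫 = n + 1
  chooseZero≡ : ∀ n (n<k : n ℕ.< k) → lookupℕ idx0 (φ⁻¹ n) ≡ just (lookup idx0 (φ k ⟨$⟩ˡ fromℕ< n<k))
  chooseZero≡ n n<k = trans (cong (lookupℕ idx0) (inverseIndex≡ φ k n n<k)) (lookupℕ-lookup idx0 _)

  private
    unlabelledAt : ℤ → (ℤ × ℤ) × Bool → Bool
    unlabelledAt ℓ c = (proj₂ (proj₁ c) == ℓ) ∧ not (proj₂ c)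

    rightmostUnlabelled≡ : ∀ ℓ lab → rightmostUnlabelled ℓ T lab ≡ lastHit (unlabelledAt ℓ) 0 (zip T lab)
    rightmostUnlabelled≡ ℓ lab = cong (λ z → last (map proj₁ (filterᵇ (λ p → unlabelledAt ℓ (proj₂ p)) z))) (indexed≡enumerateFrom0 (zip T lab))

  rightmostUnlabelled-sound : ∀ ℓ lab j → rightmostUnlabelled ℓ T lab ≡ just j →
    ∃[ a ] (lookupℕ T j ≡ just a × lookupℕ lab j ≡ just false × proj₂ a ≡ ℓ)
  rightmostUnlabelled-sound ℓ lab j e with lastHit-sound (unlabelledAt ℓ) 0 (zip T lab) j (trans (sym (rightmostUnlabelled≡ ℓ lab)) e)
  ... | t , (a , l) , refl , e′ , hit with lookupℕ-zip⁻ T lab t e′ | ∧≡true⁻ (proj₂ a == ℓ) (not l) hit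
  ...   | Tt≡a , labt≡l | at-ℓ , unlabelled = a , Tt≡a , trans labt≡l (cong just (BP.not-injective unlabelled)) , ==⇒≡ at-ℓ

  rightmostUnlabelled-maximal : ∀ ℓ lab i {a} → lookupℕ T i ≡ just a → lookupℕ lab i ≡ just false → proj₂ a ≡ ℓ →
    ∃[ j ] (rightmostUnlabelled ℓ T lab ≡ just j × i ℕ.≤ j)
  rightmostUnlabelled-maximal ℓ lab i {a} e e′ a-at-ℓ
    with lastHit-maximal (unlabelledAt ℓ) 0 (zip T lab) i (a , false) (lookupℕ-zip T lab i e e′)
           (trans (BP.∧-identityʳ _) (trans (cong (_== ℓ) a-at-ℓ) (==-refl ℓ)))
  ... | j , e″ , i≤j = j , trans (rightmostUnlabelled≡ ℓ lab) e″ , i≤j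

  one : ℤ × ℤ → ℕ
  one _ = 1

  record PathInv (it : ℕ) (cur : ℤ) (lab : List Bool) (acc : List ℤ) : Set where
    field
      length-lab : length lab ≡ N
      count : labelledTotal one T lab ℕ.+ it ≡ N
      -- the labelled arrows form a walk from level 0 to level cur
      walk : ∀ ℓ → labelledTotal (startsAt ℓ) T lab ℕ.+ 𝟙 (cur == ℓ) ≡ labelledTotal (endsAt ℓ) T lab ℕ.+ 𝟙 (0ℤ == ℓ)
      cur≡sum : cur ≡ sumℤ acc
      ranks-nonneg : All (0ℤ ℤ.≤_) (startRanks acc)
      labelled≤absSum : ∀ i {a} → lookupℕ T i ≡ just a → lookupℕ lab i ≡ just true → proj₂ a ℤ.≤ + absSum acc

  lab-defined : ∀ (lab : List Bool) → length lab ≡ N → ∀ i {a : ℤ × ℤ} → lookupℕ T i ≡ just a → ∃[ x ] lookupℕ lab i ≡ just x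
  lab-defined lab len i e = <⇒lookupℕ-just lab i (subst (i ℕ.<_) (sym len) (lookupℕ-just⇒< T i e))

  path-step : ∀ {it cur lab acc} j b lvl → PathInv (suc it) cur lab acc →
    lookupℕ T j ≡ just (b , lvl) → lookupℕ lab j ≡ just false → lvl ≡ cur →
    PathInv it (lvl + b) (setTrue lab j) (acc ++ [ b ])
  path-step {it} {cur} {lab} {acc} j b lvl I Tj unlab lvl≡cur = record
    { length-lab = trans (length-setTrue lab j) length-lab
    ; count = trans (cong (ℕ._+ it) (labelledTotal-setTrue one T lab j Tj unlab)) (trans (sym (ℕP.+-suc _ it)) count)
    ; walk = walk′
    ; cur≡sum = trans (cong (_+ b) (trans lvl≡cur cur≡sum)) (sym (sumℤ-snoc acc b))
    ; ranks-nonneg = subst (All (0ℤ ℤ.≤_)) (sym (startRanks-snoc acc b))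
                       (AllP.++⁺ ranks-nonneg (subst (0ℤ ℤ.≤_) (trans lvl≡cur cur≡sum) (All⇒lookupℕ T levels-nonneg j Tj) ∷ []))
    ; labelled≤absSum = labelled≤absSum′
    }
    where
    open PathInv I
    walk′ : ∀ ℓ → labelledTotal (startsAt ℓ) T (setTrue lab j) ℕ.+ 𝟙 ((lvl + b) == ℓ)
                ≡ labelledTotal (endsAt ℓ) T (setTrue lab j) ℕ.+ 𝟙 (0ℤ == ℓ)
    walk′ ℓ = begin
      labelledTotal (startsAt ℓ) T (setTrue lab j) ℕ.+ E₁
        ≡⟨ cong (ℕ._+ E₁) (labelledTotal-setTrue (startsAt ℓ) T lab j Tj unlab) ⟩
      (𝟙 (lvl == ℓ) ℕ.+ S) ℕ.+ E₁
        ≡⟨ cong (λ z → (𝟙 (z == ℓ) ℕ.+ S) ℕ.+ E₁) lvl≡cur ⟩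
      (𝟙 (cur == ℓ) ℕ.+ S) ℕ.+ E₁
        ≡⟨ cong (ℕ._+ E₁) (trans (ℕP.+-comm _ S) (walk ℓ)) ⟩
      (E ℕ.+ 𝟙 (0ℤ == ℓ)) ℕ.+ E₁
        ≡⟨ xy∙z≈zx∙y E _ E₁ ⟩
      (E₁ ℕ.+ E) ℕ.+ 𝟙 (0ℤ == ℓ)
        ≡⟨ cong (ℕ._+ 𝟙 (0ℤ == ℓ)) (labelledTotal-setTrue (endsAt ℓ) T lab j Tj unlab) ⟨
      labelledTotal (endsAt ℓ) T (setTrue lab j) ℕ.+ 𝟙 (0ℤ == ℓ) ∎
      where
      open ≡-Reasoning
      S = labelledTotal (startsAt ℓ) T lab
      E = labelledTotal (endsAt ℓ) T lab
      E₁ = 𝟙 ((lvl + b) == ℓ)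
    labelled≤absSum′ : ∀ i {a} → lookupℕ T i ≡ just a → lookupℕ (setTrue lab j) i ≡ just true → proj₂ a ℤ.≤ + absSum (acc ++ [ b ])
    labelled≤absSum′ i Ti labelled with i ℕ.≟ j
    ... | yes refl rewrite just-injective (trans (sym Ti) Tj) =
          ℤP.≤-trans (subst (ℤ._≤ + absSum acc) (sym (trans lvl≡cur cur≡sum)) (sumℤ≤absSum acc)) (absSum-≤-snoc acc b)
    ... | no i≢j = ℤP.≤-trans (labelled≤absSum i Ti (trans (sym (lookupℕ-setTrue-≢ lab j i i≢j)) labelled)) (absSum-≤-snoc acc b)

  stepsAt : ℤ → List Bool → List ℤ
  stepsAt r lab = map proj₁ (labelledWhere (λ a → proj₂ a == r) T lab)

  record OrderInv (n : ℕ) (lab : List Bool) (acc : List ℤ) : Set where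
    field
      n≤k : n ℕ.≤ k
      later-unlabelled : ∀ m j → n ℕ.≤ m → m ℕ.< k → lookupℕ idx0 (φ⁻¹ m) ≡ just j → lookupℕ lab j ≡ just false
      earlier-labelled : ∀ m j → m ℕ.< n → lookupℕ idx0 (φ⁻¹ m) ≡ just j → lookupℕ lab j ≡ just true
      zero-steps : stepsAtRank 0ℤ acc ≡ map (zeroStep ∘ φ⁻¹) (upTo n)
      rank-steps : ∀ r → ¬ r ≡ 0ℤ → reverse (stepsAtRank r acc) ≡ stepsAt r lab
      suffix : LabelledSuffix T lab

  module _ {n lab acc} (O : OrderInv n lab acc) (n<k : n ℕ.< k) {j} (idx0≡j : lookupℕ idx0 (φ⁻¹ n) ≡ just j) where
    open OrderInv O

    private
      sound : ∃[ a ] (lookupℕ T j ≡ just a × proj₂ a ≡ 0ℤ × zeroStep (φ⁻¹ n) ≡ proj₁ a)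
      sound = idx0-sound (φ⁻¹ n) j idx0≡j

    chosen-unlabelled : lookupℕ lab j ≡ just false
    chosen-unlabelled = later-unlabelled n j ℕP.≤-refl n<k idx0≡j

    chosen-at-zero : ∀ {b lvl} → lookupℕ T j ≡ just (b , lvl) → lvl ≡ 0ℤ
    chosen-at-zero Tj = trans (cong proj₂ (just-injective (trans (sym Tj) (proj₁ (proj₂ sound))))) (proj₁ (proj₂ (proj₂ sound)))

    order-step-zero : ∀ {b lvl} → sumℤ acc ≡ 0ℤ → lookupℕ T j ≡ just (b , lvl) → OrderInv (suc n) (setTrue lab j) (acc ++ [ b ])
    order-step-zero {b} {lvl} sum≡0 Tj = record
      { n≤k = n<k
      ; later-unlabelled = later-unlabelled′
      ; earlier-labelled = earlier-labelled′
      ; zero-steps = zero-steps′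
      ; rank-steps = rank-steps′
      ; suffix = suffix′
      }
      where
      lvl≡0 : lvl ≡ 0ℤ
      lvl≡0 = chosen-at-zero Tj
      b≡ : zeroStep (φ⁻¹ n) ≡ b
      b≡ = trans (proj₂ (proj₂ (proj₂ sound))) (cong proj₁ (just-injective (trans (sym (proj₁ (proj₂ sound))) Tj)))
      later-unlabelled′ : ∀ m j′ → suc n ℕ.≤ m → m ℕ.< k → lookupℕ idx0 (φ⁻¹ m) ≡ just j′ →
                          lookupℕ (setTrue lab j) j′ ≡ just false
      later-unlabelled′ m j′ n<m m<k e = trans (lookupℕ-setTrue-≢ lab j j′ j′≢j) (later-unlabelled m j′ (ℕP.<⇒≤ n<m) m<k e)
        where
        j′≢j : ¬ j′ ≡ j
        j′≢j refl = ℕP.<-irrefl (sym (inverseIndex-injective φ k m n m<k n<k (idx0-injective (φ⁻¹ m) (φ⁻¹ n) j′ e idx0≡j))) n<m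
      earlier-labelled′ : ∀ m j′ → m ℕ.< suc n → lookupℕ idx0 (φ⁻¹ m) ≡ just j′ → lookupℕ (setTrue lab j) j′ ≡ just true
      earlier-labelled′ m j′ m≤n e with m ℕ.≟ n
      ... | yes refl rewrite just-injective (trans (sym e) idx0≡j) = lookupℕ-setTrue-≡ lab j chosen-unlabelled
      ... | no m≢n = lookupℕ-setTrue-true lab j j′ (earlier-labelled m j′ (ℕP.≤∧≢⇒< (ℕP.≤-pred m≤n) m≢n) e)
      zero-steps′ : stepsAtRank 0ℤ (acc ++ [ b ]) ≡ map (zeroStep ∘ φ⁻¹) (upTo (suc n))
      zero-steps′ rewrite stepsAtRank-snoc 0ℤ acc b | sum≡0 | zero-steps = begin
        map (zeroStep ∘ φ⁻¹) (upTo n) ++ [ b ]                   ≡⟨ cong (λ z → map (zeroStep ∘ φ⁻¹) (upTo n) ++ [ z ]) b≡ ⟨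
        map (zeroStep ∘ φ⁻¹) (upTo n) ++ map (zeroStep ∘ φ⁻¹) [ n ] ≡⟨ LP.map-++ (zeroStep ∘ φ⁻¹) (upTo n) [ n ] ⟨
        map (zeroStep ∘ φ⁻¹) (upTo n ++ [ n ])                    ≡⟨ cong (map (zeroStep ∘ φ⁻¹)) (LP.upTo-∷ʳ n) ⟩
        map (zeroStep ∘ φ⁻¹) (upTo (suc n))                       ∎
        where open ≡-Reasoning
      rank-steps′ : ∀ r → ¬ r ≡ 0ℤ → reverse (stepsAtRank r (acc ++ [ b ])) ≡ stepsAt r (setTrue lab j)
      rank-steps′ r r≢0
        rewrite stepsAtRank-snoc r acc b | ≢⇒==-false {sumℤ acc} {r} (λ e → r≢0 (trans (sym e) sum≡0))
              | labelledWhere-setTrue-no (λ a → proj₂ a == r) T lab j Tj (≢⇒==-false (λ e → r≢0 (trans (sym e) lvl≡0)))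
        = trans (cong reverse (LP.++-identityʳ (stepsAtRank r acc))) (rank-steps r r≢0)
      suffix′ : LabelledSuffix T (setTrue lab j)
      suffix′ i i′ i<i′ Ti Ti′ same nonzero labelled with i ℕ.≟ j
      ... | yes refl = ⊥-elim (nonzero (trans (cong proj₂ (just-injective (trans (sym Ti) Tj))) lvl≡0))
      ... | no i≢j = lookupℕ-setTrue-true lab j i′ (suffix i i′ i<i′ Ti Ti′ same nonzero (trans (sym (lookupℕ-setTrue-≢ lab j i i≢j)) labelled))

  order-step-away : ∀ {n lab acc cur} j b lvl → length lab ≡ N → OrderInv n lab acc → ¬ cur ≡ 0ℤ → sumℤ acc ≡ cur →
    lookupℕ T j ≡ just (b , lvl) → lookupℕ lab j ≡ just false → lvl ≡ cur →
    (∀ i {a} → lookupℕ T i ≡ just a → lookupℕ lab i ≡ just false → proj₂ a ≡ cur → i ℕ.≤ j) →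
    OrderInv n (setTrue lab j) (acc ++ [ b ])
  order-step-away {n} {lab} {acc} {cur} j b lvl len O cur≢0 sum≡cur Tj unlab lvl≡cur rightmost = record
    { n≤k = n≤k
    ; later-unlabelled = later-unlabelled′
    ; earlier-labelled = λ m j′ m<n e → lookupℕ-setTrue-true lab j j′ (earlier-labelled m j′ m<n e)
    ; zero-steps = zero-steps′
    ; rank-steps = rank-steps′
    ; suffix = suffix′
    }
    where
    open OrderInv O
    level-j : ∀ {a} → lookupℕ T j ≡ just a → proj₂ a ≡ cur
    level-j e = trans (cong proj₂ (just-injective (trans (sym e) Tj))) lvl≡cur
    later-unlabelled′ : ∀ m j′ → n ℕ.≤ m → m ℕ.< k → lookupℕ idx0 (φ⁻¹ m) ≡ just j′ →
                        lookupℕ (setTrue lab j) j′ ≡ just false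
    later-unlabelled′ m j′ n≤m m<k e = trans (lookupℕ-setTrue-≢ lab j j′ j′≢j) (later-unlabelled m j′ n≤m m<k e)
      where
      j′≢j : ¬ j′ ≡ j
      j′≢j refl with idx0-sound (φ⁻¹ m) j e
      ... | a , Ta , a-at-0 , _ = cur≢0 (trans (sym (level-j Ta)) a-at-0)
    zero-steps′ : stepsAtRank 0ℤ (acc ++ [ b ]) ≡ map (zeroStep ∘ φ⁻¹) (upTo n)
    zero-steps′ rewrite stepsAtRank-snoc 0ℤ acc b | ≢⇒==-false (λ e → cur≢0 (trans (sym sum≡cur) e)) =
      trans (LP.++-identityʳ (stepsAtRank 0ℤ acc)) zero-steps
    left-of-j-unlabelled : ∀ i {a} → i ℕ.< j → lookupℕ T i ≡ just a → (proj₂ a == cur) ≡ true → lookupℕ lab i ≡ just false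
    left-of-j-unlabelled i i<j Ti at-cur with lab-defined lab len i Ti
    ... | false , e = e
    ... | true , e with () ← trans (sym unlab) (suffix i j i<j Ti Tj (trans (==⇒≡ at-cur) (sym lvl≡cur)) (cur≢0 ∘ trans (sym (==⇒≡ at-cur))) e)
    rank-steps′ : ∀ r → ¬ r ≡ 0ℤ → reverse (stepsAtRank r (acc ++ [ b ])) ≡ stepsAt r (setTrue lab j)
    rank-steps′ r r≢0 rewrite stepsAtRank-snoc r acc b with r ℤ.≟ cur
    ... | yes refl rewrite trans (cong (_== r) sum≡cur) (==-refl r)
                         | labelledWhere-setTrue-yes (λ a → proj₂ a == r) T lab j Tj unlab (trans (cong (_== r) lvl≡cur) (==-refl r)) left-of-j-unlabelled =
          trans (LP.reverse-++ (stepsAtRank r acc) [ b ]) (cong (b ∷_) (rank-steps r r≢0))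
    ... | no r≢cur rewrite ≢⇒==-false {sumℤ acc} {r} (λ e → r≢cur (trans (sym e) sum≡cur))
                         | labelledWhere-setTrue-no (λ a → proj₂ a == r) T lab j Tj (≢⇒==-false (λ e → r≢cur (trans (sym e) lvl≡cur))) =
          trans (cong reverse (LP.++-identityʳ (stepsAtRank r acc))) (rank-steps r r≢0)
    suffix′ : LabelledSuffix T (setTrue lab j)
    suffix′ i i′ i<i′ Ti Ti′ same nonzero labelled with i ℕ.≟ j
    ... | no i≢j = lookupℕ-setTrue-true lab j i′ (suffix i i′ i<i′ Ti Ti′ same nonzero (trans (sym (lookupℕ-setTrue-≢ lab j i i≢j)) labelled))
    ... | yes refl with lab-defined lab len i′ Ti′
    ...   | true , e = lookupℕ-setTrue-true lab j i′ e
    ...   | false , e = ⊥-elim (ℕP.<-irrefl refl (ℕP.<-≤-trans i<i′ (rightmost i′ Ti′ e (trans (sym same) (level-j Ti)))))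

  path-init : PathInv N 0ℤ (replicate N false) []
  path-init = record
    { length-lab = LP.length-replicate N
    ; count = cong (ℕ._+ N) (labelledTotal-unlabelled one T N)
    ; walk = λ ℓ → cong (ℕ._+ 𝟙 (0ℤ == ℓ)) (trans (labelledTotal-unlabelled (startsAt ℓ) T N) (sym (labelledTotal-unlabelled (endsAt ℓ) T N)))
    ; cur≡sum = refl
    ; ranks-nonneg = []
    ; labelled≤absSum = λ i _ e → case lookupℕ-replicate⁻ N false i e of λ ()
    }

  order-init : OrderInv 0 (replicate N false) []
  order-init = record
    { n≤k = z≤n
    ; later-unlabelled = λ m j _ _ e → lookupℕ-replicate N false j (lookupℕ-just⇒< T j (proj₁ (proj₂ (idx0-sound (φ⁻¹ m) j e))))
    ; earlier-labelled = λ _ _ ()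
    ; zero-steps = refl
    ; rank-steps = λ r _ → sym (cong (map proj₁) (labelledWhere-none (λ a → proj₂ a == r) T N))
    ; suffix = λ i _ _ _ _ _ _ e → case lookupℕ-replicate⁻ N false i e of λ ()
    }

  some-unlabelled : ∀ {it cur lab acc} → PathInv (suc it) cur lab acc → 1 ℕ.≤ unlabelledTotal one T lab
  some-unlabelled {it} {lab = lab} I = ℕP.+-cancelˡ-≤ (labelledTotal one T lab) 1 _ (begin
    labelledTotal one T lab ℕ.+ 1                               ≤⟨ ℕP.+-monoʳ-≤ (labelledTotal one T lab) (s≤s z≤n) ⟩
    labelledTotal one T lab ℕ.+ suc it                          ≡⟨ count ⟩
    N                                                           ≡⟨ total-1≡length T ⟨
    total one T                                                 ≡⟨ labelled+unlabelled≡total one T lab length-lab ⟨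
    labelledTotal one T lab ℕ.+ unlabelledTotal one T lab       ∎)
    where
    open PathInv I
    open ℕP.≤-Reasoning

  -- by balance, a walk from level 0 can always be continued until it returns to 0
  unlabelled-at-cur : ∀ {it cur lab acc} → PathInv it cur lab acc → ¬ cur ≡ 0ℤ →
    ∃[ i ] ∃[ a ] (lookupℕ T i ≡ just a × lookupℕ lab i ≡ just false × proj₂ a ≡ cur)
  unlabelled-at-cur {cur = cur} {lab} I cur≢0 with unlabelledTotal-pos (startsAt cur) T lab starts-left
    where
    open PathInv I
    open ℕP.≤-Reasoning
    S = labelledTotal (startsAt cur) T lab
    split : ∀ w → labelledTotal w T lab ℕ.+ unlabelledTotal w T lab ≡ total w T
    split w = labelled+unlabelled≡total w T lab length-lab
    starts-left : 1 ℕ.≤ unlabelledTotal (startsAt cur) T lab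
    starts-left = ℕP.+-cancelˡ-≤ S 1 _ (begin
      S ℕ.+ 1                                                   ≡⟨ cong (λ z → S ℕ.+ 𝟙 z) (==-refl cur) ⟨
      S ℕ.+ 𝟙 (cur == cur)                                      ≡⟨ walk cur ⟩
      labelledTotal (endsAt cur) T lab ℕ.+ 𝟙 (0ℤ == cur)        ≡⟨ cong (λ z → labelledTotal (endsAt cur) T lab ℕ.+ 𝟙 z) (≢⇒==-false (cur≢0 ∘ sym)) ⟩
      labelledTotal (endsAt cur) T lab ℕ.+ 0                    ≤⟨ ℕP.+-monoʳ-≤ _ z≤n ⟩
      labelledTotal (endsAt cur) T lab ℕ.+ unlabelledTotal (endsAt cur) T lab ≡⟨ split (endsAt cur) ⟩
      total (endsAt cur) T                                      ≡⟨ balanced cur ⟨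
      total (startsAt cur) T                                    ≡⟨ split (startsAt cur) ⟨
      S ℕ.+ unlabelledTotal (startsAt cur) T lab                ∎)
  ... | i , a , Ti , unlab , starts = i , a , Ti , unlab , ==⇒≡ (𝟙-pos⇒true _ starts)

  Outcome : List ℤ ⊎ List Bool → Set
  Outcome (inj₁ out) = GeneralDyck out × Osweep φ out ≡ map proj₁ T
  Outcome (inj₂ lab) = Admissible (shift T lab) × levelSum (shift T lab) ℕ.< levelSum T × length T ≡ length lab

  stuck : ∀ {it n lab acc} → PathInv (suc it) 0ℤ lab acc → OrderInv n lab acc → ¬ n ℕ.< k → Outcome (inj₂ lab)
  stuck {lab = lab} I O n≮k =
    record { levels-nonneg = shift-levels-nonneg G len off0
           ; balanced = shift-balanced G len off0 closed
           ; sorted = shift-sorted G len off0 suffix }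
    , levelSum-shift-< G len off0 (some-unlabelled I)
    , len
    where
    open PathInv I
    open OrderInv O
    len : length T ≡ length lab
    len = sym length-lab
    n≡k : _ ≡ k
    n≡k = ℕP.≤-antisym n≤k (ℕP.≮⇒≥ n≮k)
    closed : ∀ ℓ → labelledTotal (startsAt ℓ) T lab ≡ labelledTotal (endsAt ℓ) T lab
    closed ℓ = ℕP.+-cancelʳ-≡ _ _ _ (walk ℓ)
    off0 : UnlabelledOffZero T lab
    off0 i Ti unlab at-0 with idx0-complete i Ti at-0
    ... | t , idx0t with inverseIndex-surjective φ k t (lookupℕ-just⇒< idx0 t idx0t)
    ...   | m , m<k , φ⁻¹m≡t =
            case trans (sym unlab) (earlier-labelled m i (subst (m ℕ.<_) (sym n≡k) m<k) (trans (cong (lookupℕ idx0) φ⁻¹m≡t) idx0t)) of λ ()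

  module Finished {cur n lab acc} (I : PathInv 0 cur lab acc) (O : OrderInv n lab acc) where
    open PathInv I
    open OrderInv O

    labelled : ∀ i {a} → lookupℕ T i ≡ just a → lookupℕ lab i ≡ just true
    labelled i Ti with lab-defined lab length-lab i Ti
    ... | true , e = e
    ... | false , e = ⊥-elim (ℕP.<-irrefl refl (ℕP.≤-trans (unlabelledTotal-≥ one T lab i Ti e) (ℕP.≤-reflexive none-left)))
      where
      none-left : unlabelledTotal one T lab ≡ 0
      none-left = ℕP.+-cancelˡ-≡ (labelledTotal one T lab) _ _
                    (trans (labelled+unlabelled≡total one T lab length-lab) (trans (total-1≡length T) (sym count)))

    all-labelled : All (_≡ true) lab
    all-labelled = lookupℕ⇒All lab λ i e →
      let (a , Ti) = <⇒lookupℕ-just T i (subst (i ℕ.<_) length-lab (lookupℕ-just⇒< lab i e)) in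
      just-injective (trans (sym e) (labelled i Ti))

    labelledTotal≡total : ∀ w → labelledTotal w T lab ≡ total w T
    labelledTotal≡total w = trans (sym (ℕP.+-identityʳ _))
      (trans (cong (labelledTotal w T lab ℕ.+_) (sym (unlabelledTotal-labelled w T lab all-labelled)))
             (labelled+unlabelled≡total w T lab length-lab))

    -- a walk through every arrow of a balanced diagram ends where it started
    cur≡0 : cur ≡ 0ℤ
    cur≡0 = sym (==⇒≡ (𝟙-pos⇒true _ (ℕP.≤-reflexive (ℕP.+-cancelˡ-≡ (labelledTotal (endsAt cur) T lab) _ _ (begin
      labelledTotal (endsAt cur) T lab ℕ.+ 1                    ≡⟨ cong (ℕ._+ 1) (labelledTotal≡total (endsAt cur)) ⟩
      total (endsAt cur) T ℕ.+ 1                                ≡⟨ cong (ℕ._+ 1) (trans (sym (balanced cur)) (sym (labelledTotal≡total (startsAt cur)))) ⟩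
      labelledTotal (startsAt cur) T lab ℕ.+ 1                  ≡⟨ cong (λ z → labelledTotal (startsAt cur) T lab ℕ.+ 𝟙 z) (==-refl cur) ⟨
      labelledTotal (startsAt cur) T lab ℕ.+ 𝟙 (cur == cur)     ≡⟨ walk cur ⟩
      labelledTotal (endsAt cur) T lab ℕ.+ 𝟙 (0ℤ == cur)        ∎)))))
      where open ≡-Reasoning

    n≡k : n ≡ k
    n≡k with n ℕ.<? k
    ... | no n≮k = ℕP.≤-antisym n≤k (ℕP.≮⇒≥ n≮k)
    ... | yes n<k with <⇒lookupℕ-just idx0 (φ⁻¹ n) (inverseIndex-< φ k n n<k)
    ...   | j , e = case trans (sym (later-unlabelled n j ℕP.≤-refl n<k e)) (labelled j (proj₁ (proj₂ (idx0-sound (φ⁻¹ n) j e)))) of λ ()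

    rank-zero : rankZeroPart φ (stepsAtRank 0ℤ acc) ≡ zeroSteps
    rank-zero = begin
      rankZeroPart φ L                   ≡⟨ rankZeroPart-inverse φ L zeroStep entries ⟩
      map zeroStep (upTo (length L))     ≡⟨ cong (λ K → map zeroStep (upTo K)) length-L ⟩
      map zeroStep (upTo k)              ≡⟨ map-zeroStep-upTo ⟩
      zeroSteps                          ∎
      where
      open ≡-Reasoning
      L = stepsAtRank 0ℤ acc
      L≡ : L ≡ map (zeroStep ∘ φ⁻¹) (upTo k)
      L≡ = trans zero-steps (cong (λ z → map (zeroStep ∘ φ⁻¹) (upTo z)) n≡k)
      length-L : length L ≡ k
      length-L = trans (cong length L≡) (trans (LP.length-map _ (upTo k)) (LP.length-upTo k))
      entries : ∀ m → m ℕ.< length L → lookupℕ L m ≡ just (zeroStep (inverseIndex φ (length L) m))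
      entries m m<L rewrite length-L =
        trans (cong (λ z → lookupℕ z m) L≡) (lookupℕ-map (zeroStep ∘ φ⁻¹) (upTo k) m (lookupℕ-applyUpTo (λ i → i) k m m<L))

    higher-ranks : map (λ m → reverse (stepsAtRank (+ suc m) acc)) (upTo (absSum acc))
                 ≡ map (λ m → map proj₁ (atLevel (+ suc m) T)) (upTo (absSum acc))
    higher-ranks = LP.map-cong (λ m → trans (rank-steps (+ suc m) (λ ()))
                                           (cong (map proj₁) (labelledWhere-all _ T lab all-labelled (sym length-lab))))
                               (upTo (absSum acc))

    levels-in-range : All (LevelIn 0 (suc (absSum acc))) T
    levels-in-range = lookupℕ⇒All T λ i {a} Ti →
      within (proj₂ a) (All⇒lookupℕ T levels-nonneg i Ti) (labelled≤absSum i Ti (labelled i Ti))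
      where
      within : ∀ l → 0ℤ ℤ.≤ l → l ℤ.≤ + absSum acc → ∃[ m ] (l ≡ + m × 0 ℕ.≤ m × m ℕ.< suc (absSum acc))
      within (+ m) _ (ℤ.+≤+ m≤M) = m , refl , z≤n , s≤s m≤M

    result : Outcome (inj₁ acc)
    result = (trans (sym cur≡sum) cur≡0 , ranks-nonneg)
           , trans (cong₂ (λ u v → u ++ concat v) rank-zero higher-ranks) (map-proj₁-levels (absSum acc) T sorted levels-in-range)

  loop : ∀ it cur n lab acc → PathInv it cur lab acc → OrderInv n lab acc → Outcome (roundLoop φ T idx0 it cur n lab acc)
  loop zero cur n lab acc I O = Finished.result I O
  loop (suc it) cur n lab acc I O with cur == 0ℤ in at-0
  ... | true with refl ← ==⇒≡ {cur} {0ℤ} at-0 | n ℕ.<? length idx0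
  ...   | no n≮k = stuck I O n≮k
  ...   | yes n<k with lookupℕ T (lookup idx0 (φ k ⟨$⟩ˡ fromℕ< n<k)) in Tj
  ...     | nothing = case trans (sym Tj) (proj₁ (proj₂ (idx0-sound (φ⁻¹ n) _ (chooseZero≡ n n<k)))) of λ ()
  ...     | just (b , lvl) =
            loop it (lvl + b) (suc n) (setTrue lab j) (acc ++ [ b ])
                 (path-step j b lvl I Tj (chosen-unlabelled O n<k idx0≡j) (chosen-at-zero O n<k idx0≡j Tj))
                 (order-step-zero O n<k idx0≡j (sym (PathInv.cur≡sum I)) Tj)
    where
    j : ℕ
    j = lookup idx0 (φ k ⟨$⟩ˡ fromℕ< n<k)
    idx0≡j : lookupℕ idx0 (φ⁻¹ n) ≡ just j
    idx0≡j = chooseZero≡ n n<k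
  loop (suc it) cur n lab acc I O | false with rightmostUnlabelled cur T lab in rj
  ... | nothing with unlabelled-at-cur I cur≢0
    where
    cur≢0 : ¬ cur ≡ 0ℤ
    cur≢0 refl = case trans (sym at-0) (==-refl 0ℤ) of λ ()
  ...   | i , a , Ti , unlab , at-cur with rightmostUnlabelled-maximal cur lab i Ti unlab at-cur
  ...     | j , rj′ , _ = case trans (sym rj) rj′ of λ ()
  loop (suc it) cur n lab acc I O | false | just j with rightmostUnlabelled-sound cur lab j rj
  ... | a , Tj , unlab , at-cur with lookupℕ T j in Tj′
  ...   | nothing = case Tj of λ ()
  ...   | just (b , lvl) =
          loop it (lvl + b) n (setTrue lab j) (acc ++ [ b ])
               (path-step j b lvl I Tj′ unlab lvl≡cur)
               (order-step-away j b lvl (PathInv.length-lab I) O cur≢0 (sym (PathInv.cur≡sum I)) Tj′ unlab lvl≡cur rightmost)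
    where
    cur≢0 : ¬ cur ≡ 0ℤ
    cur≢0 refl = case trans (sym at-0) (==-refl 0ℤ) of λ ()
    lvl≡cur : lvl ≡ cur
    lvl≡cur = trans (cong proj₂ (just-injective Tj)) at-cur
    rightmost : ∀ i {a} → lookupℕ T i ≡ just a → lookupℕ lab i ≡ just false → proj₂ a ≡ cur → i ℕ.≤ j
    rightmost i Ti unlab′ at-cur′ with rightmostUnlabelled-maximal cur lab i Ti unlab′ at-cur′
    ... | j′ , rj′ , i≤j′ = subst (i ℕ.≤_) (just-injective (trans (sym rj′) rj)) i≤j′

  round-outcome : Outcome (round φ T)
  round-outcome = loop N 0ℤ 0 (replicate N false) [] path-init order-init

hpathRun-outcome : ∀ φ fuel T → Admissible T → levelSum T ℕ.< fuel →
  ∃[ out ] (hpathRun φ fuel T ≡ just out × GeneralDyck out × Osweep φ out ≡ map proj₁ T)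
hpathRun-outcome φ (suc fuel) T G lt with round φ T | Round.round-outcome φ T G
... | inj₁ out | dyck , sweep = out , refl , dyck , sweep
... | inj₂ lab | G′ , decreases , len with hpathRun-outcome φ fuel (shift T lab) G′ (ℕP.≤-trans decreases (ℕP.≤-pred lt))
...   | out , run , dyck , sweep = out , run , dyck , trans sweep (map-proj₁-shift T lab len)

proposition3 : (φ : PermFamily) (D : List ℤ) (R : List ℕ) →
    length D ≡ length R → Balanced D R → Increasing R →
    ∃[ fuel ] ∃[ Dbar ] ((HPath φ fuel D R ≡ just Dbar) × GeneralDyck Dbar × (Osweep φ Dbar ≡ D))
proposition3 φ D R len bal inc
  with hpathRun-outcome φ (suc (levelSum (diagram D R))) (diagram D R) (admissible-diagram D R len bal inc) ℕP.≤-refl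
... | out , run , dyck , sweep = suc (levelSum (diagram D R)) , out , run , dyck , trans sweep steps≡D
  where
  steps≡D : map proj₁ (diagram D R) ≡ D
  steps≡D = map-proj₁-zip D (map +_ R) (trans len (sym (LP.length-map +_ R)))
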